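{- For every integer $k\ge2$, $$\sum_{n\ge1}x^n\,\#\{w\in\mathcal F_{n,k}: G(w)\text{ has a Hamiltonian cycle}\}=\frac{x(1+x)\bigl(2-x-x^{2\lfloor k/2\rfloor}\bigr)}{1-x-2x^2+x^3+x^{2\lfloor k/2\rfloor+2}}.$$
   Context: For integers $k\ge 2$, $n\ge1$, $\mathcal F_{n,k}$ is the set of binary words $w=w_1\cdots w_n$ with no $k$ consecutive $1$'s. $P(w)$ is the bargraph polyomino formed by the unit squares $[i-1,i]\times[j-1,j]$, $1\le i\le n$, $1\le j\le w_i+1$. $G(w)$ is the graph whose vertices are the corners of the cells of $P(w)$ and whose edges are the cell sides. A Hamiltonian cycle is a cycle visiting every vertex exactly once. -}

module Defs where

open import Data.Bool using (Bool; true; false; if_then_else_)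
open import Data.Nat as ℕ using (ℕ; zero; suc; _<_; _≤_; _<ᵇ_; _≡ᵇ_; _/_)
open import Data.Integer as ℤ using (ℤ; +_)
open import Data.Fin using (fromℕ<)
open import Data.Vec using (Vec; lookup)
open import Data.List using (List; []; _∷_; _++_; [_]; length)
open import Data.List.Membership.Propositional using (_∈_)
open import Data.List.Relation.Unary.Unique.Propositional using (Unique)
open import Data.List.Relation.Unary.Linked using (Linked)
open import Data.Product using (Σ; ∃; ∃-syntax; _×_; _,_)
open import Data.Sum using (_⊎_)
open import Relation.Nullary using (¬_)
open import Relation.Binary.PropositionalEquality using (_≡_)
open import Data.Nat.Properties using (≤-refl)

Word : ℕ → Set
Word n = Vec Bool n

-- bit w x = w_{x+1} (0-based position x); false outside the word
bit : ∀ {n} → Word n → ℕ → Bool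
bit {n} w x with x ℕ.<? n
... | Relation.Nullary.yes p = lookup w (fromℕ< p)
... | Relation.Nullary.no _  = false
  where import Relation.Nullary

NoKOnes : ∀ {n} → ℕ → Word n → Set
NoKOnes k w = ∀ i → ¬ (∀ j → j < k → bit w (i ℕ.+ j) ≡ true)

-- Bargraph P(w): column x (0-based, occupying [x,x+1]) has height w_{x+1}+1.

colHeight : ∀ {n} → Word n → ℕ → ℕ
colHeight {n} w x = if x <ᵇ n then (if bit w x then 2 else 1) else 0

-- the unit square [x,x+1] × [y,y+1] is a cell of P(w)
Cell : ∀ {n} → Word n → ℕ → ℕ → Set
Cell w x y = y < colHeight w x

Point : Set
Point = ℕ × ℕ

Vertex : ∀ {n} → Word n → Point → Set
Vertex w (x , y) = ∃[ c ] ∃[ r ] (Cell w c r × (x ≡ c ⊎ x ≡ suc c) × (y ≡ r ⊎ y ≡ suc r))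

-- the horizontal unit segment (x,y)–(x+1,y) is a side of some cell
HSide : ∀ {n} → Word n → Point → Set
HSide w (x , y) = ∃[ r ] (Cell w x r × (y ≡ r ⊎ y ≡ suc r))

-- the vertical unit segment (x,y)–(x,y+1) is a side of some cell
VSide : ∀ {n} → Word n → Point → Set
VSide w (x , y) = ∃[ c ] (Cell w c y × (x ≡ c ⊎ x ≡ suc c))

Adj : ∀ {n} → Word n → Point → Point → Set
Adj w (x , y) (x' , y') =
    (x' ≡ suc x × y' ≡ y × HSide w (x , y))
  ⊎ (x ≡ suc x' × y ≡ y' × HSide w (x' , y'))
  ⊎ (x' ≡ x × y' ≡ suc y × VSide w (x , y))
  ⊎ (x ≡ x' × y ≡ suc y' × VSide w (x' , y'))

IsHamCycle : ∀ {n} → Word n → List Point → Set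
IsHamCycle w [] = Data.Empty.⊥
  where import Data.Empty
IsHamCycle w (v ∷ vs) =
  3 ≤ length (v ∷ vs)
  × Unique (v ∷ vs)
  × (∀ p → Vertex w p → p ∈ (v ∷ vs))
  × (∀ p → p ∈ (v ∷ vs) → Vertex w p)
  × Linked (Adj w) ((v ∷ vs) ++ [ v ])

HasHamCycle : ∀ {n} → Word n → Set
HasHamCycle w = ∃[ vs ] IsHamCycle w vs

CountIs : (n : ℕ) → (Word n → Set) → ℕ → Set
CountIs n P c = Σ (List (Word n)) λ L →
  Unique L × (∀ w → (w ∈ L → P w) × (P w → w ∈ L)) × length L ≡ c

Series : Set
Series = ℕ → ℤ

Xpow : ℕ → Series
Xpow e n = if n ≡ᵇ e then + 1 else + 0

const : ℤ → Series
const c n = if n ≡ᵇ 0 then c else + 0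

_⊕_ : Series → Series → Series
(f ⊕ g) n = f n ℤ.+ g n

_⊖_ : Series → Series → Series
(f ⊖ g) n = f n ℤ.- g n

sumTo : (ℕ → ℤ) → ℕ → ℤ
sumTo f zero = f zero
sumTo f (suc m) = sumTo f m ℤ.+ f (suc m)

_⊛_ : Series → Series → Series
(f ⊛ g) n = sumTo (λ i → f i ℤ.* g (n ℕ.∸ i)) n

infixl 6 _⊕_ _⊖_
infixl 7 _⊛_

genFun : (ℕ → ℕ) → Series
genFun a zero = + 0
genFun a (suc n) = + a (suc n)

denom : ℕ → Series
denom k = const (+ 1) ⊖ Xpow 1 ⊖ const (+ 2) ⊛ Xpow 2 ⊕ Xpow 3
          ⊕ Xpow (2 ℕ.* (k / 2) ℕ.+ 2)

numer : ℕ → Series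
numer k = Xpow 1 ⊛ (const (+ 1) ⊕ Xpow 1)
          ⊛ (const (+ 2) ⊖ Xpow 1 ⊖ Xpow (2 ℕ.* (k / 2)))

-- G(w) has a Hamiltonian cycle exactly when every maximal run of ones in w has odd
-- length.  For such w the cycle runs right along heights 0 and 1, zig-zagging between
-- them below the interior of each run, and returns left along heights 1 and 2.
-- Conversely, in a Hamiltonian cycle every vertex has degree two and every vertical line
-- between two columns is crossed an even, nonzero number of times, hence by exactly two of
-- the three horizontal edges at heights 0, 1 and 2.  Propagating these local constraints
-- along a run shows that the middle edge after column c is used iff the run of ones
-- ending at c has even length, and that a run cannot end while this edge is used.
-- Counting words with odd runs shorter than k by the length of the current run
-- gives, with m = ⌊k/2⌋, A = B + xD, B = 1 + xA and (1 - x²)D = (1 - x^{2m})B, which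
-- solves to the stated rational function.

module Submission where

open import Defs
open import Data.Bool using (Bool; true; false; if_then_else_; T; _∧_; _∨_; not; _xor_)
open import Data.Bool.Properties using (∧-zeroʳ; ∨-zeroʳ; ∨-comm; not-involutive; xor-comm; xor-same)
open import Data.Nat as ℕ using (ℕ; zero; suc; _<ᵇ_; _≡ᵇ_; _≤_; _<_; z≤n; s≤s; _/_; _%_)
import Data.Nat.Properties as ℕP
open import Data.Nat.DivMod using (m/n*n≤m; m≡m%n+[m/n]*n; m%n<n)
import Data.Nat.Tactic.RingSolver as ℕSolver
open import Data.Integer using (ℤ; +_; _+_; _-_; _*_)
import Data.Integer.Properties as ℤP
open import Data.Integer.Tactic.RingSolver using (solve-∀)
open import Data.Fin using (fromℕ<)
open import Data.Vec using ([]; _∷_; lookup)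
open import Data.Vec.Properties using (∷-injectiveˡ; ∷-injectiveʳ)
open import Data.List using (List; []; _∷_; _++_; [_]; length; map)
open import Data.List.Properties using (++-assoc; length-++; length-map)
open import Data.List.Membership.Propositional using (_∈_)
open import Data.List.Membership.Propositional.Properties using (∈-map⁺; ∈-map⁻; ∈-++⁺ˡ; ∈-++⁺ʳ; ∈-++⁻)
import Data.List.Membership.DecPropositional as DecMembership
open import Data.List.Relation.Unary.Any using (here; there)
open import Data.List.Relation.Unary.Unique.Propositional using (Unique)
open import Data.List.Relation.Unary.Unique.Propositional.Properties using (++⁺; map⁺; map⁻)
import Data.List.Relation.Unary.AllPairs as AllPairs
import Data.List.Relation.Unary.All as All
open import Data.List.Relation.Unary.Linked using (Linked; [-]; _∷_)
open import Data.Product using (Σ; ∃; _×_; _,_; proj₁; proj₂)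
open import Data.Product.Properties using (≡-dec)
open import Data.Sum using (_⊎_; inj₁; inj₂; [_,_]′)
open import Data.Empty using (⊥; ⊥-elim)
open import Function using (id; _∘_)
open import Relation.Nullary using (¬_; Dec; yes; no; does)
open import Relation.Binary.Definitions using (DecidableEquality)
open import Relation.Binary.PropositionalEquality hiding ([_])

-- Power series

shift : ℕ → Series → Series
shift zero    f n       = f n
shift (suc e) f zero    = + 0
shift (suc e) f (suc n) = shift e f n

shift-shift : ∀ a b f n → shift a (shift b f) n ≡ shift (a ℕ.+ b) f n
shift-shift zero    b f n       = refl
shift-shift (suc a) b f zero    = refl
shift-shift (suc a) b f (suc n) = shift-shift a b f n

shift-⊕ : ∀ e f g n → shift e (f ⊕ g) n ≡ shift e f n + shift e g n
shift-⊕ zero    f g n       = refl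
shift-⊕ (suc e) f g zero    = refl
shift-⊕ (suc e) f g (suc n) = shift-⊕ e f g n

shift-⊖ : ∀ e f g n → shift e (f ⊖ g) n ≡ shift e f n - shift e g n
shift-⊖ zero    f g n       = refl
shift-⊖ (suc e) f g zero    = refl
shift-⊖ (suc e) f g (suc n) = shift-⊖ e f g n

shift-cong : ∀ e {f g} → (∀ i → f i ≡ g i) → ∀ n → shift e f n ≡ shift e g n
shift-cong zero    f≗g n       = f≗g n
shift-cong (suc e) f≗g zero    = refl
shift-cong (suc e) f≗g (suc n) = shift-cong e f≗g n

shift-const : ∀ e c n → shift e (const c) n ≡ c * Xpow e n
shift-const zero    c zero    = sym (ℤP.*-identityʳ c)
shift-const zero    c (suc n) = sym (ℤP.*-zeroʳ c)
shift-const (suc e) c zero    = sym (ℤP.*-zeroʳ c)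
shift-const (suc e) c (suc n) = shift-const e c n

shift-Xpow : ∀ e j n → shift e (Xpow j) n ≡ Xpow (e ℕ.+ j) n
shift-Xpow zero    j n       = refl
shift-Xpow (suc e) j zero    = refl
shift-Xpow (suc e) j (suc n) = shift-Xpow e j n

shift-zero : ∀ e n → shift e (λ _ → + 0) n ≡ + 0
shift-zero zero    n       = refl
shift-zero (suc e) zero    = refl
shift-zero (suc e) (suc n) = shift-zero e n

sumTo-cong : ∀ {f g} → (∀ i → f i ≡ g i) → ∀ m → sumTo f m ≡ sumTo g m
sumTo-cong f≗g zero    = f≗g zero
sumTo-cong f≗g (suc m) = cong₂ _+_ (sumTo-cong f≗g m) (f≗g (suc m))

sumTo-+ : ∀ f g m → sumTo (λ i → f i + g i) m ≡ sumTo f m + sumTo g m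
sumTo-+ f g zero    = refl
sumTo-+ f g (suc m) rewrite sumTo-+ f g m = interchange (sumTo f m) (sumTo g m) (f (suc m)) (g (suc m))
  where
  interchange : ∀ a b c d → (a + b) + (c + d) ≡ (a + c) + (b + d)
  interchange = solve-∀

sumTo-- : ∀ f g m → sumTo (λ i → f i - g i) m ≡ sumTo f m - sumTo g m
sumTo-- f g zero    = refl
sumTo-- f g (suc m) rewrite sumTo-- f g m = interchange (sumTo f m) (sumTo g m) (f (suc m)) (g (suc m))
  where
  interchange : ∀ a b c d → (a - b) + (c - d) ≡ (a + c) - (b + d)
  interchange = solve-∀

sumTo-* : ∀ c f m → sumTo (λ i → c * f i) m ≡ c * sumTo f m
sumTo-* c f zero    = refl
sumTo-* c f (suc m) rewrite sumTo-* c f m = sym (ℤP.*-distribˡ-+ c (sumTo f m) (f (suc m)))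

sumTo-suc : ∀ f n → sumTo f (suc n) ≡ f zero + sumTo (λ i → f (suc i)) n
sumTo-suc f zero    = refl
sumTo-suc f (suc n) rewrite sumTo-suc f n = ℤP.+-assoc (f zero) _ _

sumTo-zero : ∀ {f} → (∀ i → f i ≡ + 0) → ∀ n → sumTo f n ≡ + 0
sumTo-zero f≗0 zero    = f≗0 zero
sumTo-zero f≗0 (suc n) rewrite sumTo-zero f≗0 n | f≗0 (suc n) = refl

Xpow-⊛ : ∀ e f n → (Xpow e ⊛ f) n ≡ shift e f n
Xpow-⊛ zero    f zero    = ℤP.*-identityˡ (f zero)
Xpow-⊛ zero    f (suc n)
  rewrite sumTo-suc (λ i → Xpow zero i * f (suc n ℕ.∸ i)) n
        | sumTo-zero {λ i → Xpow zero (suc i) * f (n ℕ.∸ i)} (λ _ → refl) n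
  = trans (ℤP.+-identityʳ _) (ℤP.*-identityˡ (f (suc n)))
Xpow-⊛ (suc e) f zero    = refl
Xpow-⊛ (suc e) f (suc n)
  rewrite sumTo-suc (λ i → Xpow (suc e) i * f (suc n ℕ.∸ i)) n
  = trans (ℤP.+-identityˡ _) (Xpow-⊛ e f n)

⊛-congˡ : ∀ {f f'} h → (∀ i → f i ≡ f' i) → ∀ n → (f ⊛ h) n ≡ (f' ⊛ h) n
⊛-congˡ h f≗f' n = sumTo-cong (λ i → cong (_* h (n ℕ.∸ i)) (f≗f' i)) n

⊛-distribʳ-⊕ : ∀ f g h n → ((f ⊕ g) ⊛ h) n ≡ (f ⊛ h) n + (g ⊛ h) n
⊛-distribʳ-⊕ f g h n =
  trans (sumTo-cong (λ i → ℤP.*-distribʳ-+ (h (n ℕ.∸ i)) (f i) (g i)) n) (sumTo-+ _ _ n)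

⊛-distribʳ-⊖ : ∀ f g h n → ((f ⊖ g) ⊛ h) n ≡ (f ⊛ h) n - (g ⊛ h) n
⊛-distribʳ-⊖ f g h n = trans (sumTo-cong (λ i → distrib (f i) (g i) (h (n ℕ.∸ i))) n) (sumTo-- _ _ n)
  where
  distrib : ∀ a b c → (a - b) * c ≡ a * c - b * c
  distrib = solve-∀

const-⊛ : ∀ c f n → (const c ⊛ f) n ≡ c * f n
const-⊛ c f n = begin
  (const c ⊛ f) n                                 ≡⟨ ⊛-congˡ f (shift-const 0 c) n ⟩
  sumTo (λ i → (c * Xpow 0 i) * f (n ℕ.∸ i)) n    ≡⟨ sumTo-cong (λ i → ℤP.*-assoc c _ _) n ⟩
  sumTo (λ i → c * (Xpow 0 i * f (n ℕ.∸ i))) n    ≡⟨ sumTo-* c _ n ⟩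
  c * (Xpow 0 ⊛ f) n                              ≡⟨ cong (c *_) (Xpow-⊛ 0 f n) ⟩
  c * f n                                         ∎
  where open ≡-Reasoning

denomAt : ℕ → Series → Series
denomAt m g i = g i - shift 1 g i - + 2 * shift 2 g i + shift 3 g i + shift (2 ℕ.* m ℕ.+ 2) g i

denom-⊛ : ∀ k g i → (denom k ⊛ g) i ≡ denomAt (k ℕ./ 2) g i
denom-⊛ k g i = begin
  (denom k ⊛ g) i
    ≡⟨ ⊛-distribʳ-⊕ (one ⊖ Xpow 1 ⊖ 2x² ⊕ Xpow 3) (Xpow e) g i ⟩
  ((one ⊖ Xpow 1 ⊖ 2x² ⊕ Xpow 3) ⊛ g) i + (Xpow e ⊛ g) i
    ≡⟨ cong (_+ (Xpow e ⊛ g) i) (⊛-distribʳ-⊕ (one ⊖ Xpow 1 ⊖ 2x²) (Xpow 3) g i) ⟩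
  ((one ⊖ Xpow 1 ⊖ 2x²) ⊛ g) i + (Xpow 3 ⊛ g) i + (Xpow e ⊛ g) i
    ≡⟨ cong (λ z → z + (Xpow 3 ⊛ g) i + (Xpow e ⊛ g) i) (⊛-distribʳ-⊖ (one ⊖ Xpow 1) 2x² g i) ⟩
  ((one ⊖ Xpow 1) ⊛ g) i - (2x² ⊛ g) i + (Xpow 3 ⊛ g) i + (Xpow e ⊛ g) i
    ≡⟨ cong (λ z → z - (2x² ⊛ g) i + (Xpow 3 ⊛ g) i + (Xpow e ⊛ g) i) (⊛-distribʳ-⊖ one (Xpow 1) g i) ⟩
  (one ⊛ g) i - (Xpow 1 ⊛ g) i - (2x² ⊛ g) i + (Xpow 3 ⊛ g) i + (Xpow e ⊛ g) i
    ≡⟨ cong₂ _+_ (cong₂ _+_ (cong₂ _-_ (cong₂ _-_ one-⊛ (Xpow-⊛ 1 g i)) 2x²-⊛) (Xpow-⊛ 3 g i)) (Xpow-⊛ e g i) ⟩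
  denomAt (k ℕ./ 2) g i ∎
  where
  open ≡-Reasoning
  e : ℕ
  e = 2 ℕ.* (k ℕ./ 2) ℕ.+ 2
  one 2x² : Series
  one = const (+ 1)
  2x² = const (+ 2) ⊛ Xpow 2
  one-⊛ : (one ⊛ g) i ≡ g i
  one-⊛ = trans (const-⊛ (+ 1) g i) (ℤP.*-identityˡ (g i))
  2x²-⊛ : (2x² ⊛ g) i ≡ + 2 * shift 2 g i
  2x²-⊛ = begin
    (2x² ⊛ g) i                    ≡⟨ ⊛-congˡ g (const-⊛ (+ 2) (Xpow 2)) i ⟩
    ((λ j → + 2 * Xpow 2 j) ⊛ g) i ≡⟨ sumTo-cong (λ j → ℤP.*-assoc (+ 2) (Xpow 2 j) _) i ⟩
    _                              ≡⟨ sumTo-* (+ 2) _ i ⟩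
    + 2 * (Xpow 2 ⊛ g) i           ≡⟨ cong (+ 2 *_) (Xpow-⊛ 2 g i) ⟩
    + 2 * shift 2 g i              ∎

denomAt-⊖ : ∀ m f g i → denomAt m (f ⊖ g) i ≡ denomAt m f i - denomAt m g i
denomAt-⊖ m f g i
  rewrite shift-⊖ 1 f g i | shift-⊖ 2 f g i | shift-⊖ 3 f g i | shift-⊖ (2 ℕ.* m ℕ.+ 2) f g i
  = linear (f i) (g i) (shift 1 f i) (shift 1 g i) (shift 2 f i) (shift 2 g i)
           (shift 3 f i) (shift 3 g i) (shift (2 ℕ.* m ℕ.+ 2) f i) (shift (2 ℕ.* m ℕ.+ 2) g i)
  where
  linear : ∀ a a' b b' c c' d d' e e' →
    (a - a') - (b - b') - + 2 * (c - c') + (d - d') + (e - e')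
      ≡ (a - b - + 2 * c + d + e) - (a' - b' - + 2 * c' + d' + e')
  linear = solve-∀

shift-Xpow0 : ∀ e n → shift e (Xpow 0) n ≡ Xpow e n
shift-Xpow0 e n = trans (shift-Xpow e 0 n) (cong (λ j → Xpow j n) (ℕP.+-identityʳ e))

numer-coeff : ∀ k i → numer k i ≡
  (+ 2 * Xpow 1 i - Xpow 2 i - Xpow (1 ℕ.+ 2 ℕ.* (k ℕ./ 2)) i)
  + (+ 2 * Xpow 2 i - Xpow 3 i - Xpow (2 ℕ.+ 2 ℕ.* (k ℕ./ 2)) i)
numer-coeff k i = begin
  numer k i                        ≡⟨ ⊛-congˡ Q x+x² i ⟩
  ((Xpow 1 ⊕ Xpow 2) ⊛ Q) i        ≡⟨ ⊛-distribʳ-⊕ (Xpow 1) (Xpow 2) Q i ⟩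
  (Xpow 1 ⊛ Q) i + (Xpow 2 ⊛ Q) i  ≡⟨ cong₂ _+_ (Xpow-⊛ 1 Q i) (Xpow-⊛ 2 Q i) ⟩
  shift 1 Q i + shift 2 Q i        ≡⟨ cong₂ _+_ (shift-Q 1) (shift-Q 2) ⟩
  _                                ∎
  where
  open ≡-Reasoning
  M : ℕ
  M = 2 ℕ.* (k ℕ./ 2)
  Q : Series
  Q = const (+ 2) ⊖ Xpow 1 ⊖ Xpow M
  x+x² : ∀ j → (Xpow 1 ⊛ (const (+ 1) ⊕ Xpow 1)) j ≡ (Xpow 1 ⊕ Xpow 2) j
  x+x² j = trans (Xpow-⊛ 1 (const (+ 1) ⊕ Xpow 1) j)
             (trans (shift-⊕ 1 (const (+ 1)) (Xpow 1) j) (cong₂ _+_ (shift-Xpow 1 0 j) (shift-Xpow 1 1 j)))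
  shift-Q : ∀ e → shift e Q i ≡ + 2 * Xpow e i - Xpow (e ℕ.+ 1) i - Xpow (e ℕ.+ M) i
  shift-Q e rewrite shift-⊖ e (const (+ 2) ⊖ Xpow 1) (Xpow M) i | shift-⊖ e (const (+ 2)) (Xpow 1) i
    | shift-const e (+ 2) i | shift-Xpow e 1 i | shift-Xpow e M i = refl

denom-⊛-genFun : ∀ k (A : ℕ → ℕ) → A 0 ≡ 1 →
  (∀ i → denomAt (k ℕ./ 2) (λ n → + A n) i
           ≡ Xpow 0 i + Xpow 1 i - Xpow 2 i - Xpow (1 ℕ.+ 2 ℕ.* (k ℕ./ 2)) i) →
  ∀ i → (denom k ⊛ genFun A) i ≡ numer k i
denom-⊛-genFun k A A0≡1 recurrence i = begin
  (denom k ⊛ genFun A) i                          ≡⟨ denom-⊛ k (genFun A) i ⟩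
  denomAt m (genFun A) i                          ≡⟨ denomAt-cong ⟩
  denomAt m (seq ⊖ Xpow 0) i                      ≡⟨ denomAt-⊖ m seq (Xpow 0) i ⟩
  denomAt m seq i - denomAt m (Xpow 0) i          ≡⟨ cong₂ _-_ (recurrence i) denom-coeff ⟩
  (x 0 + x 1 - x 2 - x (1 ℕ.+ 2 ℕ.* m))
    - (x 0 - x 1 - + 2 * x 2 + x 3 + x (2 ℕ.+ 2 ℕ.* m))
                                                  ≡⟨ difference (x 0) (x 1) (x 2) (x 3) _ _ ⟩
  (+ 2 * x 1 - x 2 - x (1 ℕ.+ 2 ℕ.* m)) + (+ 2 * x 2 - x 3 - x (2 ℕ.+ 2 ℕ.* m))
                                                  ≡⟨ sym (numer-coeff k i) ⟩
  numer k i                                       ∎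
  where
  open ≡-Reasoning
  m : ℕ
  m = k ℕ./ 2
  seq : Series
  seq n = + A n
  x : ℕ → ℤ
  x e = Xpow e i
  genFun≗ : ∀ j → genFun A j ≡ (seq ⊖ Xpow 0) j
  genFun≗ zero    rewrite A0≡1 = refl
  genFun≗ (suc j) = sym (ℤP.+-identityʳ (+ A (suc j)))
  denomAt-cong : denomAt m (genFun A) i ≡ denomAt m (seq ⊖ Xpow 0) i
  denomAt-cong rewrite genFun≗ i | shift-cong 1 genFun≗ i | shift-cong 2 genFun≗ i
    | shift-cong 3 genFun≗ i | shift-cong (2 ℕ.* m ℕ.+ 2) genFun≗ i = refl
  denom-coeff : denomAt m (Xpow 0) i ≡ x 0 - x 1 - + 2 * x 2 + x 3 + x (2 ℕ.+ 2 ℕ.* m)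
  denom-coeff rewrite shift-Xpow0 1 i | shift-Xpow0 2 i | shift-Xpow0 3 i
    | shift-Xpow0 (2 ℕ.* m ℕ.+ 2) i | ℕP.+-comm (2 ℕ.* m) 2 = refl
  difference : ∀ x0 x1 x2 x3 y1 y2 →
    (x0 + x1 - x2 - y1) - (x0 - x1 - + 2 * x2 + x3 + y2) ≡ (+ 2 * x1 - x2 - y1) + (+ 2 * x2 - x3 - y2)
  difference = solve-∀

-- Runs of ones

odd : ℕ → Bool
odd zero    = false
odd (suc n) = not (odd n)

odd-+-2* : ∀ r t → odd (r ℕ.+ 2 ℕ.* t) ≡ odd r
odd-+-2* r zero    = cong odd (ℕP.+-identityʳ r)
odd-+-2* r (suc t) rewrite ℕP.*-suc 2 t | sym (ℕP.+-assoc r 2 (2 ℕ.* t)) | ℕP.+-comm r 2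
  = trans (not-involutive _) (odd-+-2* r t)

odd-2*+1 : ∀ m → odd (suc (2 ℕ.* m)) ≡ true
odd-2*+1 m = cong not (odd-+-2* 0 m)

canEnd : ℕ → Bool
canEnd r = (r ≡ᵇ 0) ∨ odd r

odd⇒canEnd : ∀ {r} → odd r ≡ true → canEnd r ≡ true
odd⇒canEnd {r} odd-r rewrite odd-r = ∨-zeroʳ (r ≡ᵇ 0)

<ᵇ-true : ∀ {r k} → r < k → (r <ᵇ k) ≡ true
<ᵇ-true {r} {k} r<k with r <ᵇ k in eq
... | true  = refl
... | false = ⊥-elim (subst T eq (ℕP.<⇒<ᵇ r<k))

<ᵇ-false : ∀ {r k} → k ≤ r → (r <ᵇ k) ≡ false
<ᵇ-false {r} {k} k≤r with r <ᵇ k in eq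
... | false = refl
... | true  = ⊥-elim (ℕP.<⇒≱ (ℕP.<ᵇ⇒< r k (subst T (sym eq) _)) k≤r)

<ᵇ-sound : ∀ {r k} → (r <ᵇ k) ≡ true → r < k
<ᵇ-sound {r} {k} eq = ℕP.<ᵇ⇒< r k (subst T (sym eq) _)

bit-< : ∀ {n} (w : Word n) x (x<n : x < n) → bit w x ≡ lookup w (fromℕ< x<n)
bit-< {n} w x x<n with x ℕ.<? n
... | yes x<n′ = cong (λ p → lookup w (fromℕ< p)) (ℕP.<-irrelevant x<n′ x<n)
... | no  x≮n  = ⊥-elim (x≮n x<n)

bit-≮ : ∀ {n} (w : Word n) x → ¬ x < n → bit w x ≡ false
bit-≮ {n} w x x≮n with x ℕ.<? n
... | yes x<n = ⊥-elim (x≮n x<n)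
... | no  _   = refl

bit-true⇒< : ∀ {n} (w : Word n) x → bit w x ≡ true → x < n
bit-true⇒< {n} w x eq with x ℕ.<? n
... | yes x<n = x<n
bit-true⇒< {n} w x () | no _

bit-∷-zero : ∀ {n} b (w : Word n) → bit (b ∷ w) 0 ≡ b
bit-∷-zero b w = bit-< (b ∷ w) 0 (s≤s z≤n)

bit-∷-suc : ∀ {n} b (w : Word n) x → bit (b ∷ w) (suc x) ≡ bit w x
bit-∷-suc {n} b w x = by-cases (x ℕ.<? n)
  where
  by-cases : Dec (x < n) → bit (b ∷ w) (suc x) ≡ bit w x
  by-cases (yes x<n) = trans (bit-< (b ∷ w) (suc x) (s≤s x<n)) (sym (bit-< w x x<n))
  by-cases (no  x≮n) = trans (bit-≮ (b ∷ w) (suc x) (λ sx<sn → x≮n (ℕP.≤-pred sx<sn))) (sym (bit-≮ w x x≮n))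

bit-[] : ∀ x → bit [] x ≡ false
bit-[] x = bit-≮ [] x (λ ())

-- run r g x is the length of the run of trues of g ending just before x,
-- when g is preceded by a run of r trues.
run : ℕ → (ℕ → Bool) → ℕ → ℕ
run r g zero    = r
run r g (suc x) = if g x then suc (run r g x) else 0

run-cong : ∀ r {g h} → (∀ x → g x ≡ h x) → ∀ x → run r g x ≡ run r h x
run-cong r g≗h zero    = refl
run-cong r g≗h (suc x) rewrite g≗h x | run-cong r g≗h x = refl

run-shift : ∀ r g x → run r g (suc x) ≡ run (if g 0 then suc r else 0) (λ y → g (suc y)) x
run-shift r g zero    = refl
run-shift r g (suc x) rewrite run-shift r g x = refl

run-true : ∀ {r g} x → g x ≡ true → run r g (suc x) ≡ suc (run r g x)
run-true x gx rewrite gx = refl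

run-false : ∀ {r g} x → g x ≡ false → run r g (suc x) ≡ 0
run-false x gx rewrite gx = refl

run-≤ : ∀ g x → run 0 g x ≤ x
run-≤ g zero = z≤n
run-≤ g (suc x) with g x
... | true  = s≤s (run-≤ g x)
... | false = z≤n

-- For g = bit w this includes a final run, as bit w is false past the end of w.
OddRuns : (ℕ → Bool) → Set
OddRuns g = ∀ x → g x ≡ false → canEnd (run 0 g x) ≡ true

Admissible : ℕ → ℕ → (ℕ → Bool) → Set
Admissible k r g = ∀ x → run r g x < k × (g x ≡ false → canEnd (run r g x) ≡ true)

Admissible-[] : ∀ {k r} → r < k → canEnd r ≡ true → Admissible k r (bit [])
Admissible-[] r<k ok zero    = r<k , λ _ → ok
Admissible-[] r<k ok (suc x) rewrite bit-[] x = ℕP.≤-trans (s≤s z≤n) r<k , λ _ → refl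

Admissible-cong : ∀ {k r g h} → (∀ x → g x ≡ h x) → Admissible k r g → Admissible k r h
Admissible-cong {r = r} {g} {h} g≗h adm x rewrite sym (run-cong r g≗h x) =
  proj₁ (adm x) , λ hx≡f → proj₂ (adm x) (trans (g≗h x) hx≡f)

Admissible-split : ∀ {k r g} → Admissible k r g →
  r < k × (g 0 ≡ false → canEnd r ≡ true) × Admissible k (if g 0 then suc r else 0) (λ y → g (suc y))
Admissible-split {k} {r} {g} adm =
  proj₁ (adm 0) , proj₂ (adm 0) ,
  λ x → subst (_< k) (run-shift r g x) (proj₁ (adm (suc x))) ,
        subst (λ s → canEnd s ≡ true) (run-shift r g x) ∘ proj₂ (adm (suc x))

Admissible-join : ∀ {k r g} → r < k → (g 0 ≡ false → canEnd r ≡ true) →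
  Admissible k (if g 0 then suc r else 0) (λ y → g (suc y)) → Admissible k r g
Admissible-join r<k ok adm zero = r<k , ok
Admissible-join {r = r} {g} r<k ok adm (suc x) rewrite run-shift r g x = adm x

Admissible-∷⁻ : ∀ {n k r} b (w : Word n) → Admissible k r (bit (b ∷ w)) →
  r < k × (b ≡ false → canEnd r ≡ true) × Admissible k (if b then suc r else 0) (bit w)
Admissible-∷⁻ b w adm with Admissible-split adm
... | r<k , ok , adm′ rewrite bit-∷-zero b w = r<k , ok , Admissible-cong (bit-∷-suc b w) adm′

Admissible-∷⁺ : ∀ {n k r} b (w : Word n) → r < k → (b ≡ false → canEnd r ≡ true) →
  Admissible k (if b then suc r else 0) (bit w) → Admissible k r (bit (b ∷ w))
Admissible-∷⁺ {k = k} {r} b w r<k ok adm =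
  Admissible-join r<k (ok ∘ trans (sym (bit-∷-zero b w)))
    (Admissible-cong (sym ∘ bit-∷-suc b w)
      (subst (λ c → Admissible k (if c then suc r else 0) (bit w)) (sym (bit-∷-zero b w)) adm))

-- Words of length n that continue a run of r ones admissibly.
words : ℕ → (n r : ℕ) → List (Word n)
words k zero    r = if (r <ᵇ k) ∧ canEnd r then [ [] ] else []
words k (suc n) r = (if (r <ᵇ k) ∧ canEnd r then map (false ∷_) (words k n 0) else [])
                 ++ (if r <ᵇ k then map (true ∷_) (words k n (suc r)) else [])

#words : ℕ → ℕ → ℕ → ℕ
#words k n r = length (words k n r)

length-if : ∀ {A : Set} b (xs : List A) → length (if b then xs else []) ≡ (if b then length xs else 0)
length-if true  xs = refl
length-if false xs = refl

#words-suc : ∀ k n r → #words k (suc n) r ≡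
  (if (r <ᵇ k) ∧ canEnd r then #words k n 0 else 0) ℕ.+ (if r <ᵇ k then #words k n (suc r) else 0)
#words-suc k n r = begin
  length (first ++ second)
    ≡⟨ length-++ first ⟩
  length first ℕ.+ length second
    ≡⟨ cong₂ ℕ._+_ (length-if ((r <ᵇ k) ∧ canEnd r) _) (length-if (r <ᵇ k) _) ⟩
  (if (r <ᵇ k) ∧ canEnd r then length (map (false ∷_) (words k n 0)) else 0)
    ℕ.+ (if r <ᵇ k then length (map (true ∷_) (words k n (suc r))) else 0)
    ≡⟨ cong₂ ℕ._+_ (cong (λ l → if (r <ᵇ k) ∧ canEnd r then l else 0) (length-map (false ∷_) (words k n 0)))
                   (cong (λ l → if r <ᵇ k then l else 0) (length-map (true ∷_) (words k n (suc r)))) ⟩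
  _ ∎
  where
  open ≡-Reasoning
  first second : List (Word (suc n))
  first = if (r <ᵇ k) ∧ canEnd r then map (false ∷_) (words k n 0) else []
  second = if r <ᵇ k then map (true ∷_) (words k n (suc r)) else []

#words-[] : ∀ {k} → 0 < k → #words k 0 0 ≡ 1
#words-[] 0<k rewrite <ᵇ-true 0<k = refl

#words-≥ : ∀ k n r → k ≤ r → #words k n r ≡ 0
#words-≥ k zero    r k≤r rewrite <ᵇ-false k≤r = refl
#words-≥ k (suc n) r k≤r rewrite #words-suc k n r | <ᵇ-false k≤r = refl

∈-if : ∀ {A : Set} {x : A} b {xs} → x ∈ (if b then xs else []) → b ≡ true × x ∈ xs
∈-if true  x∈xs = refl , x∈xs

∈-if⁺ : ∀ {A : Set} {x : A} {b xs} → b ≡ true → x ∈ xs → x ∈ (if b then xs else [])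
∈-if⁺ refl x∈xs = x∈xs

∧-true⁻ : ∀ a b → (a ∧ b) ≡ true → a ≡ true × b ≡ true
∧-true⁻ true true _ = refl , refl

∧-true⁺ : ∀ {a b} → a ≡ true → b ≡ true → (a ∧ b) ≡ true
∧-true⁺ refl refl = refl

words-sound : ∀ k n r (w : Word n) → w ∈ words k n r → Admissible k r (bit w)
words-sound k zero r [] w∈
  with ∧-true⁻ (r <ᵇ k) (canEnd r) (proj₁ (∈-if ((r <ᵇ k) ∧ canEnd r) w∈))
... | r<k , ok = Admissible-[] (<ᵇ-sound r<k) ok
words-sound k (suc n) r (b ∷ w) w∈
  with ∈-++⁻ (if (r <ᵇ k) ∧ canEnd r then map (false ∷_) (words k n 0) else []) w∈
... | inj₁ w∈₁ with ∈-if ((r <ᵇ k) ∧ canEnd r) w∈₁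
...   | c , w∈₂ with ∈-map⁻ (false ∷_) w∈₂ | ∧-true⁻ (r <ᵇ k) (canEnd r) c
...     | w′ , w′∈ , eq | r<k , ok rewrite ∷-injectiveˡ eq | ∷-injectiveʳ eq =
          Admissible-∷⁺ false w′ (<ᵇ-sound r<k) (λ _ → ok) (words-sound k n 0 w′ w′∈)
words-sound k (suc n) r (b ∷ w) w∈ | inj₂ w∈₁ with ∈-if (r <ᵇ k) w∈₁
...   | r<k , w∈₂ with ∈-map⁻ (true ∷_) w∈₂
...     | w′ , w′∈ , eq rewrite ∷-injectiveˡ eq | ∷-injectiveʳ eq =
          Admissible-∷⁺ true w′ (<ᵇ-sound r<k) (λ ()) (words-sound k n (suc r) w′ w′∈)

words-complete : ∀ k n r (w : Word n) → Admissible k r (bit w) → w ∈ words k n r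
words-complete k zero r [] adm =
  ∈-if⁺ (∧-true⁺ (<ᵇ-true (proj₁ (adm 0))) (proj₂ (adm 0) (bit-[] 0))) (here refl)
words-complete k (suc n) r (false ∷ w) adm with Admissible-∷⁻ false w adm
... | r<k , ok , adm′ =
  ∈-++⁺ˡ (∈-if⁺ (∧-true⁺ (<ᵇ-true r<k) (ok refl)) (∈-map⁺ (false ∷_) (words-complete k n 0 w adm′)))
words-complete k (suc n) r (true ∷ w) adm with Admissible-∷⁻ true w adm
... | r<k , _ , adm′ =
  ∈-++⁺ʳ (if (r <ᵇ k) ∧ canEnd r then map (false ∷_) (words k n 0) else [])
    (∈-if⁺ (<ᵇ-true r<k) (∈-map⁺ (true ∷_) (words-complete k n (suc r) w adm′)))

Unique-if : ∀ {A : Set} b {xs : List A} → Unique xs → Unique (if b then xs else [])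
Unique-if true  u = u
Unique-if false u = AllPairs.[]

words-unique : ∀ k n r → Unique (words k n r)
words-unique k zero    r = Unique-if _ (All.[] AllPairs.∷ AllPairs.[])
words-unique k (suc n) r =
  ++⁺ (Unique-if _ (map⁺ ∷-injectiveʳ (words-unique k n 0)))
      (Unique-if _ (map⁺ ∷-injectiveʳ (words-unique k n (suc r))))
      first-bits-differ
  where
  first-bits-differ : ∀ {v} → ¬ (v ∈ (if (r <ᵇ k) ∧ canEnd r then map (false ∷_) (words k n 0) else [])
                                × v ∈ (if r <ᵇ k then map (true ∷_) (words k n (suc r)) else []))
  first-bits-differ (v∈₁ , v∈₂)
    with ∈-map⁻ (false ∷_) (proj₂ (∈-if ((r <ᵇ k) ∧ canEnd r) v∈₁))
       | ∈-map⁻ (true ∷_) (proj₂ (∈-if (r <ᵇ k) v∈₂))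
  ... | _ , _ , eq₁ | _ , _ , eq₂ with ∷-injectiveˡ (trans (sym eq₁) eq₂)
  ... | ()

ones-before : ∀ g y j → j ≤ run 0 g (y ℕ.+ j) → ∀ i → i < j → g (y ℕ.+ i) ≡ true
ones-before g y (suc j) j<run i i<j rewrite ℕP.+-suc y j with g (y ℕ.+ j) in eq
ones-before g y (suc j) () i i<j | false
... | true with ℕP.m≤n⇒m<n∨m≡n (ℕP.≤-pred i<j)
...   | inj₁ i<j′ = ones-before g y j (ℕP.≤-pred j<run) i i<j′
...   | inj₂ refl = eq

ones⇒run : ∀ g y j → (∀ i → i < j → g (y ℕ.+ i) ≡ true) → j ≤ run 0 g (y ℕ.+ j)
ones⇒run g y zero    ones = z≤n
ones⇒run g y (suc j) ones rewrite ℕP.+-suc y j | ones j (ℕP.n<1+n j) =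
  s≤s (ones⇒run g y j (λ i i<j → ones i (ℕP.m<n⇒m<1+n i<j)))

NoKOnes⇒run< : ∀ {n} k (w : Word n) → NoKOnes k w → ∀ x → run 0 (bit w) x < k
NoKOnes⇒run< k w noK x with run 0 (bit w) x ℕ.<? k
... | yes r<k = r<k
... | no  r≮k = ⊥-elim (noK (x ℕ.∸ k)
        (ones-before (bit w) (x ℕ.∸ k) k (subst (λ z → k ≤ run 0 (bit w) z) (sym (ℕP.m∸n+n≡m k≤x)) k≤r)))
  where
  k≤r : k ≤ run 0 (bit w) x
  k≤r = ℕP.≮⇒≥ r≮k
  k≤x : k ≤ x
  k≤x = ℕP.≤-trans k≤r (run-≤ (bit w) x)

run<⇒NoKOnes : ∀ {n} k (w : Word n) → (∀ x → run 0 (bit w) x < k) → NoKOnes k w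
run<⇒NoKOnes k w run<k i ones = ℕP.<⇒≱ (run<k (i ℕ.+ k)) (ones⇒run (bit w) i k ones)

words-sound₀ : ∀ {n} k (w : Word n) → w ∈ words k n 0 → NoKOnes k w × OddRuns (bit w)
words-sound₀ k w w∈ = run<⇒NoKOnes k w (λ x → proj₁ (adm x)) , λ x → proj₂ (adm x)
  where
  adm : Admissible k 0 (bit w)
  adm = words-sound k _ 0 w w∈

words-complete₀ : ∀ {n} k (w : Word n) → NoKOnes k w → OddRuns (bit w) → w ∈ words k n 0
words-complete₀ k w noK oddRuns = words-complete k _ 0 w (λ x → NoKOnes⇒run< k w noK x , oddRuns x)

-- A run of even positive length r + 1 cannot end, so the next letter is forced.
#words-even : ∀ k r → odd r ≡ true → ∀ n → #words k (suc n) (suc r) ≡ #words k n (suc (suc r))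
#words-even k r odd-r n rewrite #words-suc k n (suc r) | odd-r | ∧-zeroʳ (suc r <ᵇ k) with suc r <ᵇ k in eq
... | true  = refl
... | false = sym (#words-≥ k n (suc (suc r)) (ℕP.≤-trans (ℕP.≮⇒≥ λ r<k → subst T eq (ℕP.<⇒<ᵇ r<k)) (ℕP.n≤1+n (suc r))))

#words-even-[] : ∀ k r → odd r ≡ true → #words k 0 (suc r) ≡ 0
#words-even-[] k r odd-r rewrite odd-r | ∧-zeroʳ (suc r <ᵇ k) = refl

module WordCount (k m : ℕ) (0<k : 0 < k) (2m≤k : 2 ℕ.* m ≤ k) (k≤2m+1 : k ≤ suc (2 ℕ.* m)) where

  A : Series
  A n = + #words k n 0

  B : Series
  B = Xpow 0 ⊕ shift 1 A

  -- oddRunCount t counts the admissible continuations of a run of length 2(m - t) + 1.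
  oddRunCount : ℕ → Series
  oddRunCount zero    = λ _ → + 0
  oddRunCount (suc t) = B ⊕ shift 2 (oddRunCount t)

  #words-odd : ∀ t r → r ℕ.+ 2 ℕ.* t ≡ suc (2 ℕ.* m) → ∀ n → + #words k n r ≡ oddRunCount t n
  #words-odd zero r r≡2m+1 n =
    cong +_ (#words-≥ k n r (subst (k ≤_) (sym (trans (sym (ℕP.+-identityʳ r)) r≡2m+1)) k≤2m+1))
  #words-odd (suc t) r r+2t+2≡2m+1 = count
    where
    r+2+2t≡2m+1 : suc (suc r) ℕ.+ 2 ℕ.* t ≡ suc (2 ℕ.* m)
    r+2+2t≡2m+1 = trans (cong (λ s → s ℕ.+ 2 ℕ.* t) (ℕP.+-comm 2 r))
                    (trans (ℕP.+-assoc r 2 (2 ℕ.* t)) (trans (cong (r ℕ.+_) (sym (ℕP.*-suc 2 t))) r+2t+2≡2m+1))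
    r<k : r < k
    r<k = ℕP.≤-trans (ℕP.≤-pred (ℕP.≤-trans (ℕP.m≤m+n (suc (suc r)) (2 ℕ.* t)) (ℕP.≤-reflexive r+2+2t≡2m+1))) 2m≤k
    odd-r : odd r ≡ true
    odd-r = trans (sym (odd-+-2* r (suc t))) (trans (cong odd r+2t+2≡2m+1) (odd-2*+1 m))
    count-even : ∀ n → + #words k n (suc r) ≡ shift 1 (oddRunCount t) n
    count-even zero    = cong +_ (#words-even-[] k r odd-r)
    count-even (suc n) = trans (cong +_ (#words-even k r odd-r n)) (#words-odd t (suc (suc r)) r+2+2t≡2m+1 n)
    count : ∀ n → + #words k n r ≡ oddRunCount (suc t) n
    count zero    rewrite <ᵇ-true r<k | odd-r | ∨-zeroʳ (r ℕ.≡ᵇ 0) = refl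
    count (suc n) rewrite #words-suc k n r | <ᵇ-true r<k | odd-r | ∨-zeroʳ (r ℕ.≡ᵇ 0) =
      trans (ℤP.pos-+ (#words k n 0) (#words k n (suc r))) (cong₂ _+_ (sym (ℤP.+-identityˡ (A n))) (count-even n))

  D : Series
  D = oddRunCount m

  A≗B+xD : ∀ n → A n ≡ B n + shift 1 D n
  A≗B+xD zero    = cong +_ (#words-[] 0<k)
  A≗B+xD (suc n) rewrite #words-suc k n 0 | <ᵇ-true 0<k =
    trans (ℤP.pos-+ (#words k n 0) (#words k n 1)) (cong₂ _+_ (sym (ℤP.+-identityˡ (A n))) (#words-odd m 1 refl n))

  oddRunCount-telescope : ∀ t n → oddRunCount t n - shift 2 (oddRunCount t) n ≡ B n - shift (2 ℕ.* t) B n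
  oddRunCount-telescope zero n = trans (cong (+ 0 -_) (shift-zero 2 n)) (sym (ℤP.+-inverseʳ (B n)))
  oddRunCount-telescope (suc t) n = begin
    (B n + shift 2 Dₜ n) - shift 2 (B ⊕ shift 2 Dₜ) n
      ≡⟨ cong ((B n + shift 2 Dₜ n) -_) (shift-⊕ 2 B (shift 2 Dₜ) n) ⟩
    (B n + shift 2 Dₜ n) - (shift 2 B n + shift 2 (shift 2 Dₜ) n)
      ≡⟨ regroup (B n) (shift 2 Dₜ n) (shift 2 B n) (shift 2 (shift 2 Dₜ) n) ⟩
    (B n - shift 2 B n) + (shift 2 Dₜ n - shift 2 (shift 2 Dₜ) n)
      ≡⟨ cong (λ u → (B n - shift 2 B n) + u) shifted-telescope ⟩
    (B n - shift 2 B n) + (shift 2 B n - shift (2 ℕ.* suc t) B n)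
      ≡⟨ cancel (B n) (shift 2 B n) (shift (2 ℕ.* suc t) B n) ⟩
    B n - shift (2 ℕ.* suc t) B n ∎
    where
    open ≡-Reasoning
    Dₜ : Series
    Dₜ = oddRunCount t
    regroup : ∀ a b c d → (a + b) - (c + d) ≡ (a - c) + (b - d)
    regroup = solve-∀
    cancel : ∀ a b c → (a - b) + (b - c) ≡ a - c
    cancel = solve-∀
    shifted-telescope : shift 2 Dₜ n - shift 2 (shift 2 Dₜ) n ≡ shift 2 B n - shift (2 ℕ.* suc t) B n
    shifted-telescope = begin
      shift 2 Dₜ n - shift 2 (shift 2 Dₜ) n ≡⟨ sym (shift-⊖ 2 Dₜ (shift 2 Dₜ) n) ⟩
      shift 2 (Dₜ ⊖ shift 2 Dₜ) n          ≡⟨ shift-cong 2 (oddRunCount-telescope t) n ⟩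
      shift 2 (B ⊖ shift (2 ℕ.* t) B) n    ≡⟨ shift-⊖ 2 B (shift (2 ℕ.* t) B) n ⟩
      shift 2 B n - shift 2 (shift (2 ℕ.* t) B) n
        ≡⟨ cong (shift 2 B n -_) (trans (shift-shift 2 (2 ℕ.* t) B n) (cong (λ e → shift e B n) (sym (ℕP.*-suc 2 t)))) ⟩
      shift 2 B n - shift (2 ℕ.* suc t) B n ∎

  shift-B : ∀ e j → shift e B j ≡ Xpow e j + shift (suc e) A j
  shift-B e j = trans (shift-⊕ e (Xpow 0) (shift 1 A) j)
    (cong₂ _+_ (shift-Xpow0 e j) (trans (shift-shift e 1 A j) (cong (λ d → shift d A j) (ℕP.+-comm e 1))))

  shift-A : ∀ e i → shift e A i ≡ Xpow e i + shift (suc e) A i + shift (suc e) D i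
  shift-A e i = begin
    shift e A i                          ≡⟨ shift-cong e A≗B+xD i ⟩
    shift e (B ⊕ shift 1 D) i            ≡⟨ shift-⊕ e B (shift 1 D) i ⟩
    shift e B i + shift e (shift 1 D) i
      ≡⟨ cong₂ _+_ (shift-B e i) (trans (shift-shift e 1 D i) (cong (λ s → shift s D i) (ℕP.+-comm e 1))) ⟩
    Xpow e i + shift (suc e) A i + shift (suc e) D i ∎
    where open ≡-Reasoning

  shift-D-difference : ∀ i → shift 1 D i - shift 3 D i
    ≡ (Xpow 1 i + shift 2 A i) - (Xpow (1 ℕ.+ 2 ℕ.* m) i + shift (2 ℕ.* m ℕ.+ 2) A i)
  shift-D-difference i = begin
    shift 1 D i - shift 3 D i                   ≡⟨ cong (shift 1 D i -_) (sym (shift-shift 1 2 D i)) ⟩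
    shift 1 D i - shift 1 (shift 2 D) i         ≡⟨ sym (shift-⊖ 1 D (shift 2 D) i) ⟩
    shift 1 (D ⊖ shift 2 D) i                   ≡⟨ shift-cong 1 (oddRunCount-telescope m) i ⟩
    shift 1 (B ⊖ shift (2 ℕ.* m) B) i           ≡⟨ shift-⊖ 1 B (shift (2 ℕ.* m) B) i ⟩
    shift 1 B i - shift 1 (shift (2 ℕ.* m) B) i ≡⟨ cong (shift 1 B i -_) (shift-shift 1 (2 ℕ.* m) B i) ⟩
    shift 1 B i - shift (1 ℕ.+ 2 ℕ.* m) B i     ≡⟨ cong₂ _-_ (shift-B 1 i) (shift-B (1 ℕ.+ 2 ℕ.* m) i) ⟩
    (Xpow 1 i + shift 2 A i) - (Xpow (1 ℕ.+ 2 ℕ.* m) i + shift (2 ℕ.+ 2 ℕ.* m) A i)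
      ≡⟨ cong (λ e → (Xpow 1 i + shift 2 A i) - (Xpow (1 ℕ.+ 2 ℕ.* m) i + shift e A i)) (ℕP.+-comm 2 (2 ℕ.* m)) ⟩
    (Xpow 1 i + shift 2 A i) - (Xpow (1 ℕ.+ 2 ℕ.* m) i + shift (2 ℕ.* m ℕ.+ 2) A i) ∎
    where open ≡-Reasoning

  A-recurrence : ∀ i → denomAt m A i ≡ Xpow 0 i + Xpow 1 i - Xpow 2 i - Xpow (1 ℕ.+ 2 ℕ.* m) i
  A-recurrence i = begin
    denomAt m A i
      ≡⟨ regroup (A i) (a 1) (a 2) (a 3) (a M) ⟩
    (A i - a 1) - (a 2 - a 3) - a 2 + a M
      ≡⟨ cong₂ (λ u v → u - v - a 2 + a M) (subtract (shift-A 0 i)) (subtract (shift-A 2 i)) ⟩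
    (x 0 + d 1) - (x 2 + d 3) - a 2 + a M
      ≡⟨ regroup′ (x 0) (x 2) (d 1) (d 3) (a 2) (a M) ⟩
    x 0 - x 2 + (d 1 - d 3) - a 2 + a M
      ≡⟨ cong (λ u → x 0 - x 2 + u - a 2 + a M) (shift-D-difference i) ⟩
    x 0 - x 2 + ((x 1 + a 2) - (x (1 ℕ.+ 2 ℕ.* m) + a M)) - a 2 + a M
      ≡⟨ cancel (x 0) (x 1) (x 2) (x (1 ℕ.+ 2 ℕ.* m)) (a 2) (a M) ⟩
    x 0 + x 1 - x 2 - x (1 ℕ.+ 2 ℕ.* m) ∎
    where
    open ≡-Reasoning
    M : ℕ
    M = 2 ℕ.* m ℕ.+ 2
    a d x : ℕ → ℤ
    a e = shift e A i
    d e = shift e D i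
    x e = Xpow e i
    regroup : ∀ a₀ a₁ a₂ a₃ aₘ → a₀ - a₁ - + 2 * a₂ + a₃ + aₘ ≡ (a₀ - a₁) - (a₂ - a₃) - a₂ + aₘ
    regroup = solve-∀
    regroup′ : ∀ x₀ x₂ d₁ d₃ a₂ aₘ → (x₀ + d₁) - (x₂ + d₃) - a₂ + aₘ ≡ x₀ - x₂ + (d₁ - d₃) - a₂ + aₘ
    regroup′ = solve-∀
    cancel : ∀ x₀ x₁ x₂ y a₂ aₘ → x₀ - x₂ + ((x₁ + a₂) - (y + aₘ)) - a₂ + aₘ ≡ x₀ + x₁ - x₂ - y
    cancel = solve-∀
    cancel-middle : ∀ u v w → u + v + w - v ≡ u + w
    cancel-middle = solve-∀
    subtract : ∀ {e} → a e ≡ x e + a (suc e) + d (suc e) → a e - a (suc e) ≡ x e + d (suc e)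
    subtract {e} eq = trans (cong (_- a (suc e)) eq) (cancel-middle (x e) (a (suc e)) (d (suc e)))

-- The graph G(w)

westOf southOf : Point → List Point
westOf (zero  , y) = []
westOf (suc x , y) = [ (x , y) ]
southOf (x , zero)  = []
southOf (x , suc y) = [ (x , y) ]

neighbours : Point → List Point
neighbours (x , y) = (suc x , y) ∷ (x , suc y) ∷ (westOf (x , y) ++ southOf (x , y))

suc≢ : ∀ {n} → suc n ≢ n
suc≢ ()

suc-suc≢ : ∀ {n} → suc (suc n) ≢ n
suc-suc≢ ()

neighbours-unique : ∀ p → Unique (neighbours p)
neighbours-unique (zero  , zero)  = ((λ ()) All.∷ All.[]) AllPairs.∷ (All.[] AllPairs.∷ AllPairs.[])
neighbours-unique (zero  , suc y) =
  ((λ ()) All.∷ (λ ()) All.∷ All.[]) AllPairs.∷ (((suc-suc≢ ∘ cong proj₂) All.∷ All.[]) AllPairs.∷ (All.[] AllPairs.∷ AllPairs.[]))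
neighbours-unique (suc x , zero)  =
  ((suc≢ ∘ cong proj₁) All.∷ (suc-suc≢ ∘ cong proj₁) All.∷ All.[]) AllPairs.∷
  (((suc≢ ∘ cong proj₁) All.∷ All.[]) AllPairs.∷ (All.[] AllPairs.∷ AllPairs.[]))
neighbours-unique (suc x , suc y) =
  ((suc≢ ∘ cong proj₁) All.∷ (suc-suc≢ ∘ cong proj₁) All.∷ (suc≢ ∘ cong proj₁) All.∷ All.[]) AllPairs.∷
  (((suc≢ ∘ cong proj₁) All.∷ (suc-suc≢ ∘ cong proj₂) All.∷ All.[]) AllPairs.∷
  (((suc≢ ∘ sym ∘ cong proj₁) All.∷ All.[]) AllPairs.∷ (All.[] AllPairs.∷ AllPairs.[])))

module Bargraph {n : ℕ} (w : Word (suc n)) where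

  N : ℕ
  N = suc n

  tall : ℕ → Bool
  tall = bit w

  tallLeft : ℕ → Bool
  tallLeft zero    = false
  tallLeft (suc x) = tall x

  -- (x , 2) is a vertex exactly when a column on either side of the line x is tall.
  top : ℕ → Bool
  top x = tallLeft x ∨ tall x

  tall-≥ : tall N ≡ false
  tall-≥ = bit-≮ w N (ℕP.<-irrefl refl)

  colHeight-< : ∀ {x} → x < N → colHeight w x ≡ (if tall x then 2 else 1)
  colHeight-< {x} x<N = cong (λ b → if b then (if tall x then 2 else 1) else 0) (<ᵇ-true x<N)

  colHeight-≮ : ∀ {x} → ¬ x < N → colHeight w x ≡ 0
  colHeight-≮ {x} x≮N = cong (λ b → if b then (if tall x then 2 else 1) else 0) (<ᵇ-false (ℕP.≮⇒≥ x≮N))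

  cell-bottom : ∀ x → x < N → Cell w x 0
  cell-bottom x x<N = subst (0 <_) (sym (colHeight-< x<N)) (positive (tall x))
    where
    positive : ∀ b → 0 < (if b then 2 else 1)
    positive true  = s≤s z≤n
    positive false = s≤s z≤n

  cell-upper : ∀ x → tall x ≡ true → Cell w x 1
  cell-upper x tall-x =
    subst (1 <_) (sym (trans (colHeight-< (bit-true⇒< w x tall-x)) (cong (λ b → if b then 2 else 1) tall-x)))
      (s≤s (s≤s z≤n))

  cell⁻ : ∀ c r → Cell w c r → c < N × (r ≡ 0 ⊎ r ≡ 1 × tall c ≡ true)
  cell⁻ c r cell = by-cases (c ℕ.<? N)
    where
    heights : ∀ b → tall c ≡ b → r < (if b then 2 else 1) → r ≡ 0 ⊎ r ≡ 1 × tall c ≡ true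
    heights true  _      (s≤s z≤n)       = inj₁ refl
    heights true  tall-c (s≤s (s≤s z≤n)) = inj₂ (refl , tall-c)
    heights false _      (s≤s z≤n)       = inj₁ refl
    by-cases : Dec (c < N) → c < N × (r ≡ 0 ⊎ r ≡ 1 × tall c ≡ true)
    by-cases (no c≮N)  = ⊥-elim (ℕP.n≮0 (subst (r <_) (colHeight-≮ c≮N) cell))
    by-cases (yes c<N) = c<N , heights (tall c) refl (subst (r <_) (colHeight-< c<N) cell)

  vertex-low : ∀ {x y} → x ≤ N → y ≤ 1 → Vertex w (x , y)
  vertex-low {x} x≤N y≤1 with ℕP.m≤n⇒m<n∨m≡n x≤N
  ... | inj₁ x<N = x , 0 , cell-bottom x x<N , inj₁ refl , low y≤1
    where
    low : ∀ {y} → y ≤ 1 → y ≡ 0 ⊎ y ≡ 1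
    low z≤n       = inj₁ refl
    low (s≤s z≤n) = inj₂ refl
  ... | inj₂ refl = n , 0 , cell-bottom n (ℕP.n<1+n n) , inj₂ refl , low y≤1
    where
    low : ∀ {y} → y ≤ 1 → y ≡ 0 ⊎ y ≡ 1
    low z≤n       = inj₁ refl
    low (s≤s z≤n) = inj₂ refl

  vertex-top : ∀ {x} → top x ≡ true → Vertex w (x , 2)
  vertex-top {zero}  top-x = 0 , 1 , cell-upper 0 top-x , inj₁ refl , inj₂ refl
  vertex-top {suc x} top-x with tall x in tall-x
  ... | true  = x , 1 , cell-upper x tall-x , inj₂ refl , inj₂ refl
  ... | false = suc x , 1 , cell-upper (suc x) top-x , inj₁ refl , inj₂ refl

  vertex⁻ : ∀ {x y} → Vertex w (x , y) → x ≤ N × (y ≤ 1 ⊎ y ≡ 2 × top x ≡ true)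
  vertex⁻ (c , r , cell , x≡ , y≡) with cell⁻ c r cell
  vertex⁻ (c , r , cell , inj₁ refl , y≡) | c<N , inj₁ refl = ℕP.<⇒≤ c<N , inj₁ (low y≡)
    where
    low : ∀ {y} → y ≡ 0 ⊎ y ≡ 1 → y ≤ 1
    low (inj₁ refl) = z≤n
    low (inj₂ refl) = s≤s z≤n
  vertex⁻ (c , r , cell , inj₂ refl , y≡) | c<N , inj₁ refl = c<N , inj₁ (low y≡)
    where
    low : ∀ {y} → y ≡ 0 ⊎ y ≡ 1 → y ≤ 1
    low (inj₁ refl) = z≤n
    low (inj₂ refl) = s≤s z≤n
  vertex⁻ (c , r , cell , inj₁ refl , inj₁ refl) | c<N , inj₂ (refl , _) = ℕP.<⇒≤ c<N , inj₁ (s≤s z≤n)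
  vertex⁻ (c , r , cell , inj₂ refl , inj₁ refl) | c<N , inj₂ (refl , _) = c<N , inj₁ (s≤s z≤n)
  vertex⁻ (c , r , cell , inj₁ refl , inj₂ refl) | c<N , inj₂ (refl , tall-c) =
    ℕP.<⇒≤ c<N , inj₂ (refl , trans (cong (tallLeft c ∨_) tall-c) (∨-zeroʳ (tallLeft c)))
  vertex⁻ (c , r , cell , inj₂ refl , inj₂ refl) | c<N , inj₂ (refl , tall-c) =
    c<N , inj₂ (refl , cong (_∨ tall (suc c)) tall-c)

  adj-sym : ∀ {p q} → Adj w p q → Adj w q p
  adj-sym {_ , _} {_ , _} (inj₁ e)               = inj₂ (inj₁ e)
  adj-sym {_ , _} {_ , _} (inj₂ (inj₁ e))        = inj₁ e
  adj-sym {_ , _} {_ , _} (inj₂ (inj₂ (inj₁ e))) = inj₂ (inj₂ (inj₂ e))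
  adj-sym {_ , _} {_ , _} (inj₂ (inj₂ (inj₂ e))) = inj₂ (inj₂ (inj₁ e))

  adj-bottom : ∀ {x} → x < N → Adj w (x , 0) (suc x , 0)
  adj-bottom {x} x<N = inj₁ (refl , refl , 0 , cell-bottom x x<N , inj₁ refl)

  adj-middle : ∀ {x} → x < N → Adj w (x , 1) (suc x , 1)
  adj-middle {x} x<N = inj₁ (refl , refl , 0 , cell-bottom x x<N , inj₂ refl)

  adj-top : ∀ {x} → tall x ≡ true → Adj w (x , 2) (suc x , 2)
  adj-top {x} tall-x = inj₁ (refl , refl , 1 , cell-upper x tall-x , inj₂ refl)

  adj-lower : ∀ {x} → x ≤ N → Adj w (x , 0) (x , 1)
  adj-lower {x} x≤N with ℕP.m≤n⇒m<n∨m≡n x≤N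
  ... | inj₁ x<N = inj₂ (inj₂ (inj₁ (refl , refl , x , cell-bottom x x<N , inj₁ refl)))
  ... | inj₂ refl = inj₂ (inj₂ (inj₁ (refl , refl , n , cell-bottom n (ℕP.n<1+n n) , inj₂ refl)))

  adj-upper : ∀ {x} → top x ≡ true → Adj w (x , 1) (x , 2)
  adj-upper {zero}  top-x = inj₂ (inj₂ (inj₁ (refl , refl , 0 , cell-upper 0 top-x , inj₁ refl)))
  adj-upper {suc x} top-x with tall x in tall-x
  ... | true  = inj₂ (inj₂ (inj₁ (refl , refl , x , cell-upper x tall-x , inj₂ refl)))
  ... | false = inj₂ (inj₂ (inj₁ (refl , refl , suc x , cell-upper (suc x) top-x , inj₁ refl)))

  adj-neighbour : ∀ {p q} → Adj w p q → q ∈ neighbours p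
  adj-neighbour {x , y} (inj₁ (refl , refl , _))               = here refl
  adj-neighbour {x , y} (inj₂ (inj₁ (refl , refl , _)))        = there (there (here refl))
  adj-neighbour {x , y} (inj₂ (inj₂ (inj₁ (refl , refl , _)))) = there (here refl)
  adj-neighbour {x , suc y} (inj₂ (inj₂ (inj₂ (refl , refl , _)))) = there (there (∈-++⁺ʳ (westOf (x , suc y)) (here refl)))

  no-edge-above : ∀ x → ¬ Adj w (x , 2) (x , 3)
  no-edge-above x (inj₁ (x≡ , _))                       = suc≢ (sym x≡)
  no-edge-above x (inj₂ (inj₁ (x≡ , _)))                = suc≢ (sym x≡)
  no-edge-above x (inj₂ (inj₂ (inj₁ (_ , _ , c , cell , _)))) with cell⁻ c 2 cell
  ... | _ , inj₁ ()
  ... | _ , inj₂ (() , _)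
  no-edge-above x (inj₂ (inj₂ (inj₂ (_ , () , _))))

  no-top-edge : ∀ c → tall c ≡ false → ¬ Adj w (c , 2) (suc c , 2)
  no-top-edge c short (inj₁ (_ , _ , r , cell , 2≡)) with cell⁻ c r cell | 2≡
  ... | _ , inj₁ refl          | inj₁ ()
  ... | _ , inj₁ refl          | inj₂ ()
  ... | _ , inj₂ (refl , tall-c) | _ with trans (sym tall-c) short
  ...   | ()
  no-top-edge c short (inj₂ (inj₁ (c≡ , _)))        = suc-suc≢ (sym c≡)
  no-top-edge c short (inj₂ (inj₂ (inj₁ (c≡ , _)))) = suc≢ c≡
  no-top-edge c short (inj₂ (inj₂ (inj₂ (c≡ , _)))) = suc≢ (sym c≡)

-- Odd runs give a Hamiltonian cycle

Walk : {A : Set} → (A → A → Set) → A → List A → A → Set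
Walk R a []      b = a ≡ b
Walk R a (c ∷ l) b = R a c × Walk R c l b

walk-++ : ∀ {A : Set} {R : A → A → Set} {a b c d} l l′ →
  Walk R a l b → R b c → Walk R c l′ d → Walk R a (l ++ c ∷ l′) d
walk-++ []      l′ refl       b~c W′ = b~c , W′
walk-++ (x ∷ l) l′ (a~x , W) b~c W′ = a~x , walk-++ l l′ W b~c W′

walk⇒linked : ∀ {A : Set} {R : A → A → Set} {a b} l → Walk R a l b → Linked R (a ∷ l)
walk⇒linked []      W         = [-]
walk⇒linked (c ∷ l) (a~c , W) = a~c ∷ walk⇒linked l W

level : Bool → ℕ
level b = if b then 1 else 0

lowerEntry lowerExit : Bool → Bool → ℕ → Point
lowerEntry i o x = x , level (i ∧ not o)
lowerExit  i o x = x , level (i ∧ o)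

lowerRest : Bool → Bool → ℕ → List Point
lowerRest i o x = if i then [ lowerExit i o x ] else []

upperEntry upperExit : Bool → Bool → ℕ → Point
upperEntry l t x = x , suc (level t)
upperExit  l t x = x , suc (level l)

upperRest : Bool → Bool → ℕ → List Point
upperRest l t x = if l xor t then [ upperExit l t x ] else []

lowerBlock-∈ : ∀ i o x {p} → p ∈ lowerEntry i o x ∷ lowerRest i o x → p ≡ (x , 0) ⊎ p ≡ (x , 1) × i ≡ true
lowerBlock-∈ true  true  x (here refl)         = inj₁ refl
lowerBlock-∈ true  true  x (there (here refl)) = inj₂ (refl , refl)
lowerBlock-∈ true  false x (here refl)         = inj₂ (refl , refl)
lowerBlock-∈ true  false x (there (here refl)) = inj₁ refl
lowerBlock-∈ false o     x (here refl)         = inj₁ refl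

lowerBlock-∋₀ : ∀ i o x → (x , 0) ∈ lowerEntry i o x ∷ lowerRest i o x
lowerBlock-∋₀ true  true  x = here refl
lowerBlock-∋₀ true  false x = there (here refl)
lowerBlock-∋₀ false o     x = here refl

lowerBlock-∋₁ : ∀ i o x → i ≡ true → (x , 1) ∈ lowerEntry i o x ∷ lowerRest i o x
lowerBlock-∋₁ true true  x _ = there (here refl)
lowerBlock-∋₁ true false x _ = here refl

lowerBlock-unique : ∀ i o x → Unique (lowerEntry i o x ∷ lowerRest i o x)
lowerBlock-unique true  true  x = ((λ ()) All.∷ All.[]) AllPairs.∷ (All.[] AllPairs.∷ AllPairs.[])
lowerBlock-unique true  false x = ((λ ()) All.∷ All.[]) AllPairs.∷ (All.[] AllPairs.∷ AllPairs.[])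
lowerBlock-unique false o     x = All.[] AllPairs.∷ AllPairs.[]

upperBlock-∈ : ∀ l t x {p} → p ∈ upperEntry l t x ∷ upperRest l t x →
  p ≡ (x , 1) × (l ∧ t) ≡ false ⊎ p ≡ (x , 2) × (l ∨ t) ≡ true
upperBlock-∈ true  true  x (here refl)         = inj₂ (refl , refl)
upperBlock-∈ false false x (here refl)         = inj₁ (refl , refl)
upperBlock-∈ true  false x (here refl)         = inj₁ (refl , refl)
upperBlock-∈ true  false x (there (here refl)) = inj₂ (refl , refl)
upperBlock-∈ false true  x (here refl)         = inj₂ (refl , refl)
upperBlock-∈ false true  x (there (here refl)) = inj₁ (refl , refl)

upperBlock-∋₁ : ∀ l t x → (l ∧ t) ≡ false → (x , 1) ∈ upperEntry l t x ∷ upperRest l t x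
upperBlock-∋₁ false false x _ = here refl
upperBlock-∋₁ true  false x _ = here refl
upperBlock-∋₁ false true  x _ = there (here refl)

upperBlock-∋₂ : ∀ l t x → (l ∨ t) ≡ true → (x , 2) ∈ upperEntry l t x ∷ upperRest l t x
upperBlock-∋₂ true  true  x _ = here refl
upperBlock-∋₂ true  false x _ = there (here refl)
upperBlock-∋₂ false true  x _ = here refl

upperBlock-unique : ∀ l t x → Unique (upperEntry l t x ∷ upperRest l t x)
upperBlock-unique true  true  x = All.[] AllPairs.∷ AllPairs.[]
upperBlock-unique false false x = All.[] AllPairs.∷ AllPairs.[]
upperBlock-unique true  false x = ((λ ()) All.∷ All.[]) AllPairs.∷ (All.[] AllPairs.∷ AllPairs.[])
upperBlock-unique false true  x = ((λ ()) All.∷ All.[]) AllPairs.∷ (All.[] AllPairs.∷ AllPairs.[])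

interior : (ℕ → Bool) → ℕ → Bool
interior g zero    = false
interior g (suc x) = g x ∧ g (suc x)

oddBefore : (ℕ → Bool) → ℕ → Bool
oddBefore g x = odd (run 0 g x)

-- The lower path leaves line x at height 1 exactly when it enters line x + 1 at
-- height 1; this is where odd runs are needed.
exit-level≡entry-level : ∀ g → OddRuns g → ∀ x →
  (interior g x ∧ oddBefore g x) ≡ (interior g (suc x) ∧ not (oddBefore g (suc x)))
exit-level≡entry-level g oddRuns zero with g 0
... | true  = sym (∧-zeroʳ (g 1))
... | false = refl
exit-level≡entry-level g oddRuns (suc x) with g x in g-x | g (suc x) in g-x+1
... | false | false = refl
... | false | true  = sym (∧-zeroʳ (g (suc (suc x))))
... | true  | false = refl
... | true  | true with g (suc (suc x)) in g-x+2
...   | true  = sym (not-involutive _)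
...   | false = cong not (trans (sym (not-involutive _)) (subst (λ r → canEnd r ≡ true) run≡ (oddRuns (suc (suc x)) g-x+2)))
  where
  run≡ : run 0 g (suc (suc x)) ≡ suc (suc (run 0 g x))
  run≡ = trans (run-true (suc x) g-x+1) (cong suc (run-true x g-x))

module Construction {n : ℕ} (w : Word (suc n)) (oddRuns : OddRuns (bit w)) where
  open Bargraph w

  entry exit : ℕ → Point
  entry x = lowerEntry (interior tall x) (oddBefore tall x) x
  exit  x = lowerExit  (interior tall x) (oddBefore tall x) x

  upEntry upExit : ℕ → Point
  upEntry x = upperEntry (tallLeft x) (tall x) x
  upExit  x = upperExit  (tallLeft x) (tall x) x

  lowerBlock upperBlock : ℕ → List Point
  lowerBlock x = entry x ∷ lowerRest (interior tall x) (oddBefore tall x) x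
  upperBlock x = upEntry x ∷ upperRest (tallLeft x) (tall x) x

  -- lowerTail x k and upperTail x are the lower path through columns x, …, x + k
  -- and the upper path through columns x, …, 0, each without its first point.
  lowerTail : ℕ → ℕ → List Point
  lowerTail x zero    = lowerRest (interior tall x) (oddBefore tall x) x
  lowerTail x (suc k) = lowerRest (interior tall x) (oddBefore tall x) x ++ entry (suc x) ∷ lowerTail (suc x) k

  upperTail : ℕ → List Point
  upperTail zero    = upperRest (tallLeft 0) (tall 0) 0
  upperTail (suc x) = upperRest (tallLeft (suc x)) (tall (suc x)) (suc x) ++ upEntry x ∷ upperTail x

  Path : Point → List Point → Point → Set
  Path = Walk (Adj w)

  lowerBlock-path : ∀ i o x → x ≤ N → Path (lowerEntry i o x) (lowerRest i o x) (lowerExit i o x)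
  lowerBlock-path true  true  x x≤N = adj-lower x≤N , refl
  lowerBlock-path true  false x x≤N = adj-sym (adj-lower x≤N) , refl
  lowerBlock-path false o     x x≤N = refl

  upperBlock-path : ∀ l t x → ((l ∨ t) ≡ true → top x ≡ true) →
    Path (upperEntry l t x) (upperRest l t x) (upperExit l t x)
  upperBlock-path true  true  x tall⇒top = refl
  upperBlock-path false false x tall⇒top = refl
  upperBlock-path true  false x tall⇒top = adj-upper (tall⇒top refl) , refl
  upperBlock-path false true  x tall⇒top = adj-sym (adj-upper (tall⇒top refl)) , refl

  adj-level : ∀ {x} b → x < N → Adj w (x , level b) (suc x , level b)
  adj-level true  x<N = adj-middle x<N
  adj-level false x<N = adj-bottom x<N

  lowerPath : ℕ → ℕ → List Point
  lowerPath x k = entry x ∷ lowerTail x k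

  upperPath : ℕ → List Point
  upperPath x = upEntry x ∷ upperTail x

  lower-join : ∀ x → x < N → Adj w (exit x) (entry (suc x))
  lower-join x x<N =
    subst (λ b → Adj w (x , level b) (entry (suc x))) (sym (exit-level≡entry-level tall oddRuns x)) (adj-level _ x<N)

  upper-join : ∀ x → x < N → Adj w (upExit (suc x)) (upEntry x)
  upper-join x x<N = adj-sym (adj-upper-level (tall x) refl)
    where
    adj-upper-level : ∀ b → tall x ≡ b → Adj w (x , suc (level b)) (suc x , suc (level b))
    adj-upper-level true  tall-x = adj-top tall-x
    adj-upper-level false _      = adj-middle x<N

  lowerPath-walk : ∀ x k → x ℕ.+ k ≤ N → Path (entry x) (lowerTail x k) (exit (x ℕ.+ k))
  lowerPath-walk x zero x≤N rewrite ℕP.+-identityʳ x = lowerBlock-path (interior tall x) (oddBefore tall x) x x≤N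
  lowerPath-walk x (suc k) x+k+1≤N rewrite ℕP.+-suc x k =
    walk-++ (lowerRest (interior tall x) (oddBefore tall x) x) (lowerTail (suc x) k)
      (lowerBlock-path (interior tall x) (oddBefore tall x) x (ℕP.<⇒≤ x<N))
      (lower-join x x<N)
      (lowerPath-walk (suc x) k x+k+1≤N)
    where
    x<N : x < N
    x<N = ℕP.≤-trans (s≤s (ℕP.m≤m+n x k)) x+k+1≤N

  upperPath-walk : ∀ x → x ≤ N → Path (upEntry x) (upperTail x) (upExit 0)
  upperPath-walk zero    _     = upperBlock-path false (tall 0) 0 (λ top-0 → top-0)
  upperPath-walk (suc x) x+1≤N =
    walk-++ (upperRest (tall x) (tall (suc x)) (suc x)) (upperTail x)
      (upperBlock-path (tall x) (tall (suc x)) (suc x) (λ top-x+1 → top-x+1))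
      (upper-join x x+1≤N) (upperPath-walk x (ℕP.≤-trans (ℕP.n≤1+n x) x+1≤N))

  cycle : List Point
  cycle = lowerPath 0 N ++ upperPath N

  turn-right : Adj w (exit N) (upEntry N)
  turn-right = subst (λ b → Adj w (N , level (b ∧ oddBefore tall N)) (upEntry N))
                 (sym no-interior) (subst (λ b → Adj w (N , 0) (N , suc (level b))) (sym tall-≥) (adj-lower ℕP.≤-refl))
    where
    no-interior : interior tall N ≡ false
    no-interior = trans (cong (tall n ∧_) tall-≥) (∧-zeroʳ (tall n))

  cycle-walk : Path (entry 0) ((lowerTail 0 N ++ upperPath N) ++ [ entry 0 ]) (entry 0)
  cycle-walk = subst (λ l → Path (entry 0) l (entry 0)) (sym (++-assoc (lowerTail 0 N) (upperPath N) [ entry 0 ]))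
    (walk-++ (lowerTail 0 N) (upperTail N ++ [ entry 0 ]) (lowerPath-walk 0 N ℕP.≤-refl) turn-right
      (walk-++ (upperTail N) [] (upperPath-walk N ℕP.≤-refl) (adj-sym (adj-lower z≤n)) refl))

  lowerBlock-column : ∀ x {p} → p ∈ lowerBlock x → proj₁ p ≡ x
  lowerBlock-column x p∈ with lowerBlock-∈ (interior tall x) (oddBefore tall x) x p∈
  ... | inj₁ refl       = refl
  ... | inj₂ (refl , _) = refl

  upperBlock-column : ∀ x {p} → p ∈ upperBlock x → proj₁ p ≡ x
  upperBlock-column x p∈ with upperBlock-∈ (tallLeft x) (tall x) x p∈
  ... | inj₁ (refl , _) = refl
  ... | inj₂ (refl , _) = refl

  lowerPath-∈⁻ : ∀ x k {p} → p ∈ lowerPath x k → x ≤ proj₁ p × proj₁ p ≤ x ℕ.+ k × p ∈ lowerBlock (proj₁ p)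
  lowerPath-∈⁻ x zero p∈ rewrite lowerBlock-column x p∈ | ℕP.+-identityʳ x = ℕP.≤-refl , ℕP.≤-refl , p∈
  lowerPath-∈⁻ x (suc k) p∈ with ∈-++⁻ (lowerBlock x) p∈
  ... | inj₁ p∈block rewrite lowerBlock-column x p∈block = ℕP.≤-refl , ℕP.m≤m+n x (suc k) , p∈block
  ... | inj₂ p∈path with lowerPath-∈⁻ (suc x) k p∈path
  ...   | x<p , p≤x+1+k , p∈block = ℕP.<⇒≤ x<p , ℕP.≤-trans p≤x+1+k (ℕP.≤-reflexive (sym (ℕP.+-suc x k))) , p∈block

  lowerPath-∈⁺ : ∀ x k x′ {p} → x ≤ x′ → x′ ≤ x ℕ.+ k → p ∈ lowerBlock x′ → p ∈ lowerPath x k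
  lowerPath-∈⁺ x zero x′ x≤x′ x′≤x p∈
    rewrite ℕP.≤-antisym x≤x′ (ℕP.≤-trans x′≤x (ℕP.≤-reflexive (ℕP.+-identityʳ x))) = p∈
  lowerPath-∈⁺ x (suc k) x′ x≤x′ x′≤x+k+1 p∈ with ℕP.m≤n⇒m<n∨m≡n x≤x′
  ... | inj₂ refl = ∈-++⁺ˡ p∈
  ... | inj₁ x<x′ =
    ∈-++⁺ʳ (lowerBlock x) (lowerPath-∈⁺ (suc x) k x′ x<x′ (ℕP.≤-trans x′≤x+k+1 (ℕP.≤-reflexive (ℕP.+-suc x k))) p∈)

  upperPath-∈⁻ : ∀ x {p} → p ∈ upperPath x → proj₁ p ≤ x × p ∈ upperBlock (proj₁ p)
  upperPath-∈⁻ zero p∈ rewrite upperBlock-column 0 p∈ = z≤n , p∈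
  upperPath-∈⁻ (suc x) p∈ with ∈-++⁻ (upperBlock (suc x)) p∈
  ... | inj₁ p∈block rewrite upperBlock-column (suc x) p∈block = ℕP.≤-refl , p∈block
  ... | inj₂ p∈path with upperPath-∈⁻ x p∈path
  ...   | p≤x , p∈block = ℕP.≤-trans p≤x (ℕP.n≤1+n x) , p∈block

  upperPath-∈⁺ : ∀ x x′ {p} → x′ ≤ x → p ∈ upperBlock x′ → p ∈ upperPath x
  upperPath-∈⁺ zero    x′ z≤n  p∈ = p∈
  upperPath-∈⁺ (suc x) x′ x′≤x+1 p∈ with ℕP.m≤n⇒m<n∨m≡n x′≤x+1
  ... | inj₂ refl  = ∈-++⁺ˡ p∈
  ... | inj₁ x′<x+1 = ∈-++⁺ʳ (upperBlock (suc x)) (upperPath-∈⁺ x x′ (ℕP.≤-pred x′<x+1) p∈)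

  lowerPath-unique : ∀ x k → Unique (lowerPath x k)
  lowerPath-unique x zero    = lowerBlock-unique (interior tall x) (oddBefore tall x) x
  lowerPath-unique x (suc k) =
    ++⁺ (lowerBlock-unique (interior tall x) (oddBefore tall x) x) (lowerPath-unique (suc x) k) disjoint
    where
    disjoint : ∀ {p} → ¬ (p ∈ lowerBlock x × p ∈ lowerPath (suc x) k)
    disjoint (p∈₁ , p∈₂) = ℕP.<-irrefl (sym (lowerBlock-column x p∈₁)) (proj₁ (lowerPath-∈⁻ (suc x) k p∈₂))

  upperPath-unique : ∀ x → Unique (upperPath x)
  upperPath-unique zero    = upperBlock-unique (tallLeft 0) (tall 0) 0
  upperPath-unique (suc x) =
    ++⁺ (upperBlock-unique (tallLeft (suc x)) (tall (suc x)) (suc x)) (upperPath-unique x) disjoint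
    where
    disjoint : ∀ {p} → ¬ (p ∈ upperBlock (suc x) × p ∈ upperPath x)
    disjoint (p∈₁ , p∈₂) = ℕP.<-irrefl (upperBlock-column (suc x) p∈₁) (s≤s (proj₁ (upperPath-∈⁻ x p∈₂)))

  -- Height 1 of line x belongs to the lower block if x is interior, else to the upper block.
  lower∩upper : ∀ x {p} → p ∈ lowerBlock x → p ∈ upperBlock x → ⊥
  lower∩upper x p∈₁ p∈₂
    with lowerBlock-∈ (interior tall x) (oddBefore tall x) x p∈₁ | upperBlock-∈ (tallLeft x) (tall x) x p∈₂
  ... | inj₁ refl              | inj₁ (() , _)
  ... | inj₁ refl              | inj₂ (() , _)
  ... | inj₂ (refl , _)        | inj₂ (() , _)
  ... | inj₂ (refl , interior-x) | inj₁ (_ , not-both) = clash x interior-x not-both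
    where
    clash : ∀ x → interior tall x ≡ true → (tallLeft x ∧ tall x) ≡ false → ⊥
    clash (suc x) i≡t n≡f with trans (sym i≡t) n≡f
    ... | ()

  cycle-unique : Unique cycle
  cycle-unique = ++⁺ (lowerPath-unique 0 N) (upperPath-unique N) disjoint
    where
    disjoint : ∀ {p} → ¬ (p ∈ lowerPath 0 N × p ∈ upperPath N)
    disjoint (p∈₁ , p∈₂) = lower∩upper _ (proj₂ (proj₂ (lowerPath-∈⁻ 0 N p∈₁))) (proj₂ (upperPath-∈⁻ N p∈₂))

  cycle-covers : ∀ p → Vertex w p → p ∈ cycle
  cycle-covers (x , y) v with vertex⁻ v
  ... | x≤N , inj₂ (refl , top-x) =
    ∈-++⁺ʳ (lowerPath 0 N) (upperPath-∈⁺ N x x≤N (upperBlock-∋₂ (tallLeft x) (tall x) x top-x))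
  ... | x≤N , inj₁ z≤n =
    ∈-++⁺ˡ (lowerPath-∈⁺ 0 N x z≤n x≤N (lowerBlock-∋₀ (interior tall x) (oddBefore tall x) x))
  ... | x≤N , inj₁ (s≤s z≤n) = middle (interior tall x) refl
    where
    interior≡ : ∀ x → interior tall x ≡ (tallLeft x ∧ tall x)
    interior≡ zero    = refl
    interior≡ (suc x) = refl
    middle : ∀ b → interior tall x ≡ b → (x , 1) ∈ cycle
    middle true  i≡t = ∈-++⁺ˡ (lowerPath-∈⁺ 0 N x z≤n x≤N (lowerBlock-∋₁ (interior tall x) (oddBefore tall x) x i≡t))
    middle false i≡f = ∈-++⁺ʳ (lowerPath 0 N)
      (upperPath-∈⁺ N x x≤N (upperBlock-∋₁ (tallLeft x) (tall x) x (trans (sym (interior≡ x)) i≡f)))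

  cycle-vertices : ∀ p → p ∈ cycle → Vertex w p
  cycle-vertices p p∈ with ∈-++⁻ (lowerPath 0 N) p∈
  ... | inj₁ p∈lower with lowerPath-∈⁻ 0 N p∈lower
  ...   | _ , x≤N , p∈block with lowerBlock-∈ (interior tall (proj₁ p)) (oddBefore tall (proj₁ p)) (proj₁ p) p∈block
  ...     | inj₁ refl       = vertex-low x≤N z≤n
  ...     | inj₂ (refl , _) = vertex-low x≤N (s≤s z≤n)
  cycle-vertices p p∈ | inj₂ p∈upper with upperPath-∈⁻ N p∈upper
  ...   | x≤N , p∈block with upperBlock-∈ (tallLeft (proj₁ p)) (tall (proj₁ p)) (proj₁ p) p∈block
  ...     | inj₁ (refl , _)     = vertex-low x≤N (s≤s z≤n)
  ...     | inj₂ (refl , top-x) = vertex-top top-x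

  cycle-length : 3 ≤ length cycle
  cycle-length rewrite length-++ (lowerPath 0 N) {upperPath N} = ℕP.+-mono-≤ {2} (s≤s (s≤s z≤n)) (s≤s z≤n)

  hamiltonian : HasHamCycle w
  hamiltonian = cycle , cycle-length , cycle-unique , cycle-covers , cycle-vertices , walk⇒linked _ cycle-walk

-- Cycles given by lists of vertices

ind : Bool → ℕ
ind true  = 1
ind false = 0

ind-∨ : ∀ a b → ¬ (a ≡ true × b ≡ true) → ind (a ∨ b) ≡ ind a ℕ.+ ind b
ind-∨ true  true  not-both = ⊥-elim (not-both (refl , refl))
ind-∨ true  false _        = refl
ind-∨ false b     _        = refl

count : {A : Set} → (A → Bool) → List A → ℕ
count P []      = 0
count P (a ∷ t) = ind (P a) ℕ.+ count P t

count-zero : ∀ {A : Set} (P : A → Bool) xs → (∀ {x} → x ∈ xs → P x ≡ false) → count P xs ≡ 0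
count-zero P []       none = refl
count-zero P (a ∷ xs) none rewrite none (here refl) = count-zero P xs (none ∘ there)

count-one : ∀ {A : Set} (P : A → Bool) xs {s} → Unique xs → s ∈ xs → P s ≡ true →
  (∀ {x} → x ∈ xs → P x ≡ true → x ≡ s) → count P xs ≡ 1
count-one P (a ∷ xs) (a∉xs AllPairs.∷ _) (here refl) Ps only rewrite Ps =
  cong suc (count-zero P xs λ {x} x∈ → others x x∈ (P x) refl)
  where
  others : ∀ x → x ∈ xs → ∀ b → P x ≡ b → b ≡ false
  others x x∈ true  Px = ⊥-elim (All.lookup a∉xs x∈ (sym (only (there x∈) Px)))
  others x x∈ false _  = refl
count-one P (a ∷ xs) (a∉xs AllPairs.∷ u) (there s∈) Ps only with P a in Pa
... | true  = ⊥-elim (All.lookup a∉xs s∈ (only (here refl) Pa))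
... | false = count-one P xs u s∈ Ps (only ∘ there)

count-split : ∀ {A : Set} (P Q R : A → Bool) xs →
  (∀ {x} → x ∈ xs → ind (P x) ≡ ind (Q x) ℕ.+ ind (R x)) → count P xs ≡ count Q xs ℕ.+ count R xs
count-split P Q R []       split = refl
count-split P Q R (a ∷ xs) split
  rewrite split (here refl) | count-split P Q R xs (λ x∈ → split (there x∈)) =
  interchange (ind (Q a)) (ind (R a)) (count Q xs) (count R xs)
  where
  interchange : ∀ a b c d → (a ℕ.+ b) ℕ.+ (c ℕ.+ d) ≡ (a ℕ.+ c) ℕ.+ (b ℕ.+ d)
  interchange = ℕSolver.solve-∀

count-split₃ : ∀ {A : Set} (P Q₀ Q₁ Q₂ : A → Bool) xs →
  (∀ {x} → x ∈ xs → ind (P x) ≡ ind (Q₀ x) ℕ.+ (ind (Q₁ x) ℕ.+ (ind (Q₂ x) ℕ.+ 0))) →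
  count P xs ≡ count Q₀ xs ℕ.+ (count Q₁ xs ℕ.+ (count Q₂ xs ℕ.+ 0))
count-split₃ P Q₀ Q₁ Q₂ []       split = refl
count-split₃ P Q₀ Q₁ Q₂ (a ∷ xs) split
  rewrite split (here refl) | count-split₃ P Q₀ Q₁ Q₂ xs (λ x∈ → split (there x∈)) =
  interchange (ind (Q₀ a)) (ind (Q₁ a)) (ind (Q₂ a)) (count Q₀ xs) (count Q₁ xs) (count Q₂ xs)
  where
  interchange : ∀ a b c d e f →
    (a ℕ.+ (b ℕ.+ (c ℕ.+ 0))) ℕ.+ (d ℕ.+ (e ℕ.+ (f ℕ.+ 0))) ≡ (a ℕ.+ d) ℕ.+ ((b ℕ.+ e) ℕ.+ ((c ℕ.+ f) ℕ.+ 0))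
  interchange = ℕSolver.solve-∀

steps : {A : Set} → List A → List (A × A)
steps (a ∷ b ∷ t) = (a , b) ∷ steps (b ∷ t)
steps _           = []

sources-steps : ∀ {A : Set} (a : A) xs b → map proj₁ (steps (a ∷ xs ++ [ b ])) ≡ a ∷ xs
sources-steps a []       b = refl
sources-steps a (c ∷ xs) b = cong (a ∷_) (sources-steps c xs b)

targets-steps : ∀ {A : Set} (a : A) xs → map proj₂ (steps (a ∷ xs)) ≡ xs
targets-steps a []       = refl
targets-steps a (b ∷ xs) = cong (b ∷_) (targets-steps b xs)

steps-linked : ∀ {A : Set} {R : A → A → Set} {xs} → Linked R xs → ∀ {a b} → (a , b) ∈ steps xs → R a b
steps-linked (r ∷ _) (here refl) = r
steps-linked (_ ∷ l) (there st)  = steps-linked l st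

last : {A : Set} → A → List A → A
last x []      = x
last x (y ∷ t) = last y t

last-++ : ∀ {A : Set} (x : A) xs v → last x (xs ++ [ v ]) ≡ v
last-++ x []       v = refl
last-++ x (y ∷ xs) v = last-++ y xs v

crosses : {A : Set} → (A → Bool) → A × A → Bool
crosses side st = side (proj₁ st) xor side (proj₂ st)

xor-assoc : ∀ a b c → a xor (b xor c) ≡ (a xor b) xor c
xor-assoc true  true  c = not-involutive c
xor-assoc true  false c = refl
xor-assoc false b     c = refl

odd-ind-+ : ∀ b m → odd (ind b ℕ.+ m) ≡ b xor odd m
odd-ind-+ true  m = refl
odd-ind-+ false m = refl

crossings-parity : ∀ {A : Set} (side : A → Bool) x t →
  odd (count (crosses side) (steps (x ∷ t))) ≡ side x xor side (last x t)
crossings-parity side x [] = sym (xor-same (side x))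
crossings-parity side x (y ∷ t)
  rewrite odd-ind-+ (crosses side (x , y)) (count (crosses side) (steps (y ∷ t))) | crossings-parity side y t
  = trans (sym (xor-assoc (side x) (side y) _))
      (cong (side x xor_) (trans (xor-assoc (side y) (side y) _) (cong (_xor side (last y t)) (xor-same (side y)))))

no-crossings : ∀ {A : Set} (side : A → Bool) x t → count (crosses side) (steps (x ∷ t)) ≡ 0 →
  ∀ {y} → y ∈ x ∷ t → side y ≡ side x
no-crossings side x t       none (here refl) = refl
no-crossings side x (y ∷ t) none (there y∈) with side x in sx | side y in sy
... | true  | true  = trans (no-crossings side y t none y∈) sy
... | false | false = trans (no-crossings side y t none y∈) sy
no-crossings side x (y ∷ t) () (there y∈) | true  | false
no-crossings side x (y ∷ t) () (there y∈) | false | true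

map-injective-on : ∀ {A B : Set} (f : A → B) {xs} → Unique (map f xs) →
  ∀ {a b} → a ∈ xs → b ∈ xs → f a ≡ f b → a ≡ b
map-injective-on f u (here refl) (here refl) _ = refl
map-injective-on f (fa∉ AllPairs.∷ _) (here refl) (there b∈) fa≡fb = ⊥-elim (All.lookup fa∉ (∈-map⁺ f b∈) fa≡fb)
map-injective-on f (fa∉ AllPairs.∷ _) (there a∈) (here refl) fa≡fb = ⊥-elim (All.lookup fa∉ (∈-map⁺ f a∈) (sym fa≡fb))
map-injective-on f (_ AllPairs.∷ u) (there a∈) (there b∈) fa≡fb = map-injective-on f u a∈ b∈ fa≡fb

Unique-rotate : ∀ {A : Set} {x : A} {xs} → Unique (x ∷ xs) → Unique (xs ++ [ x ])
Unique-rotate {x = x} {xs} (x∉xs AllPairs.∷ u) = ++⁺ u (All.[] AllPairs.∷ AllPairs.[]) disjoint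
  where
  disjoint : ∀ {y} → ¬ (y ∈ xs × y ∈ [ x ])
  disjoint (y∈ , here refl) = All.lookup x∉xs y∈ refl

module CyclicOrder {A : Set} (_≟_ : DecidableEquality A) (v : A) (vs : List A)
                   (unique : Unique (v ∷ vs)) (long : 3 ≤ length (v ∷ vs)) where

  S : List (A × A)
  S = steps (v ∷ vs ++ [ v ])

  Step : A → A → Set
  Step a b = (a , b) ∈ S

  S-unique : Unique S
  S-unique = map⁻ (subst Unique (sym (sources-steps v vs v)) unique)

  step-target-unique : ∀ {a b b′} → Step a b → Step a b′ → b ≡ b′
  step-target-unique st st′ =
    cong proj₂ (map-injective-on proj₁ (subst Unique (sym (sources-steps v vs v)) unique) st st′ refl)

  step-source-unique : ∀ {a a′ b} → Step a b → Step a′ b → a ≡ a′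
  step-source-unique st st′ =
    cong proj₁ (map-injective-on proj₂ (subst Unique (sym (targets-steps v (vs ++ [ v ]))) (Unique-rotate unique)) st st′ refl)

  step-from : ∀ {a} → a ∈ v ∷ vs → ∃ λ b → Step a b
  step-from a∈ with ∈-map⁻ proj₁ (subst (_ ∈_) (sym (sources-steps v vs v)) a∈)
  ... | (_ , b) , st , refl = b , st

  step-to : ∀ {b} → b ∈ v ∷ vs → ∃ λ a → Step a b
  step-to {b} b∈ with ∈-map⁻ proj₂ (subst (b ∈_) (sym (targets-steps v (vs ++ [ v ]))) (rotate b∈))
    where
    rotate : b ∈ v ∷ vs → b ∈ vs ++ [ v ]
    rotate (here refl) = ∈-++⁺ʳ vs (here refl)
    rotate (there b∈)  = ∈-++⁺ˡ b∈
  ... | (a , _) , st , refl = a , st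

  step-source-∈ : ∀ {a b} → Step a b → a ∈ v ∷ vs
  step-source-∈ st = subst (_ ∈_) (sources-steps v vs v) (∈-map⁺ proj₁ st)

  -- Every vertex other than a and b has its predecessor outside {a, b}, so a walk
  -- along the cycle from such a vertex never reaches {a, b}.
  no-back-step : ∀ {a b} → Step a b → Step b a → ⊥
  no-back-step {a} {b} ab ba = from-v (v ≟ a) (v ≟ b)
    where
    Out : A → Set
    Out q = q ≢ a × q ≢ b

    step-out : ∀ {y z} → Step y z → Out y → Out z
    step-out yz (y≢a , y≢b) = (λ { refl → y≢b (step-source-unique yz ba) }) , (λ { refl → y≢a (step-source-unique yz ab) })

    stays-out : ∀ x t → (∀ {p q} → (p , q) ∈ steps (x ∷ t) → Step p q) → Out x → ∀ {y} → y ∈ x ∷ t → Out y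
    stays-out x t       sub out (here refl) = out
    stays-out x (x′ ∷ t) sub out (there y∈) = stays-out x′ t (sub ∘ there) (step-out (sub (here refl)) out) y∈

    shape : ∀ xs → 3 ≤ length (v ∷ xs) → ∃ λ v₁ → ∃ λ v₂ → ∃ λ rest → xs ≡ v₁ ∷ v₂ ∷ rest
    shape (v₁ ∷ v₂ ∷ rest) _                 = v₁ , v₂ , rest , refl
    shape []               (s≤s ())
    shape (_ ∷ [])         (s≤s (s≤s ()))

    -- If v is one of the two, the second vertex of the list would have to be v again.
    from-v-back : ∀ {p q} → Step p q → Step q p → v ≡ p → ⊥
    from-v-back {p} {q} pq qp refl with shape vs long
    ... | v₁ , v₂ , rest , vs≡ = v≢v₂ (sym (step-target-unique v₁v₂ (subst (λ r → Step r v) q≡v₁ qp)))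
      where
      v≢v₂ : v ≢ v₂
      v≢v₂ with subst (λ l → Unique (v ∷ l)) vs≡ unique
      ... | (_ All.∷ v≢v₂ All.∷ _) AllPairs.∷ _ = v≢v₂
      vv₁ : Step v v₁
      vv₁ = subst (λ l → (v , v₁) ∈ steps (v ∷ l ++ [ v ])) (sym vs≡) (here refl)
      v₁v₂ : Step v₁ v₂
      v₁v₂ = subst (λ l → (v₁ , v₂) ∈ steps (v ∷ l ++ [ v ])) (sym vs≡) (there (here refl))
      q≡v₁ : q ≡ v₁
      q≡v₁ = step-target-unique pq vv₁

    from-v : Dec (v ≡ a) → Dec (v ≡ b) → ⊥
    from-v (yes v≡a) _         = from-v-back ab ba v≡a
    from-v (no _)    (yes v≡b) = from-v-back ba ab v≡b
    from-v (no v≢a)  (no v≢b)  = proj₁ (stays-out v (vs ++ [ v ]) (λ st → st) (v≢a , v≢b) (∈-++⁺ˡ (step-source-∈ ab))) refl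

  _≟₂_ : DecidableEquality (A × A)
  _≟₂_ = ≡-dec _≟_ _≟_

  open DecMembership _≟₂_ using (_∈?_)

  step? : A → A → Bool
  step? a b = does ((a , b) ∈? S)

  step?-true : ∀ {a b} → Step a b → step? a b ≡ true
  step?-true {a} {b} st with (a , b) ∈? S
  ... | yes _  = refl
  ... | no ¬st = ⊥-elim (¬st st)

  step?-sound : ∀ {a b} → step? a b ≡ true → Step a b
  step?-sound {a} {b} eq with (a , b) ∈? S
  ... | yes st = st

  used : A → A → Bool
  used a b = step? a b ∨ step? b a

  used-sym : ∀ a b → used a b ≡ used b a
  used-sym a b = ∨-comm (step? a b) (step? b a)

  used-sound : ∀ {a b} → used a b ≡ true → Step a b ⊎ Step b a
  used-sound {a} {b} eq with step? a b in ab | step? b a in ba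
  ... | true  | _    = inj₁ (step?-sound ab)
  ... | false | true = inj₂ (step?-sound ba)

  ind-used : ∀ a b → ind (used a b) ≡ ind (step? a b) ℕ.+ ind (step? b a)
  ind-used a b = ind-∨ (step? a b) (step? b a) λ (ab , ba) → no-back-step (step?-sound ab) (step?-sound ba)

  degree-two : ∀ {p} → p ∈ v ∷ vs → ∀ ns → Unique ns → (∀ {q} → Step p q ⊎ Step q p → q ∈ ns) →
    count (used p) ns ≡ 2
  degree-two {p} p∈ ns u neighbours with step-from p∈ | step-to p∈
  ... | s , ps | r , rp =
    trans (count-split (used p) (step? p) (λ q → step? q p) ns (λ {q} _ → ind-used p q))
      (cong₂ ℕ._+_ (count-one (step? p) ns u (neighbours (inj₁ ps)) (step?-true ps)
                      (λ _ pq → step-target-unique (step?-sound pq) ps))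
                   (count-one (λ q → step? q p) ns u (neighbours (inj₂ rp)) (step?-true rp)
                      (λ _ qp → step-source-unique (step?-sound qp) rp)))

  count-edge : ∀ {a b} (E : A × A → Bool) → E (a , b) ≡ true → E (b , a) ≡ true →
    (∀ {st} → st ∈ S → E st ≡ true → st ≡ (a , b) ⊎ st ≡ (b , a)) → count E S ≡ ind (used a b)
  count-edge {a} {b} E Eab Eba only with (a , b) ∈? S | (b , a) ∈? S
  ... | yes ab | yes ba = ⊥-elim (no-back-step ab ba)
  ... | yes ab | no ¬ba = count-one E S S-unique ab Eab λ st∈ Est → [ id , (λ { refl → ⊥-elim (¬ba st∈) }) ]′ (only st∈ Est)
  ... | no ¬ab | yes ba = count-one E S S-unique ba Eba λ st∈ Est → [ (λ { refl → ⊥-elim (¬ab st∈) }) , id ]′ (only st∈ Est)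
  ... | no ¬ab | no ¬ba = count-zero E S λ {st} st∈ → not-true (E st) λ Est →
                            [ (λ { refl → ¬ab st∈ }) , (λ { refl → ¬ba st∈ }) ]′ (only st∈ Est)
    where
    not-true : ∀ b → (b ≡ true → ⊥) → b ≡ false
    not-true true  ¬t = ⊥-elim (¬t refl)
    not-true false _  = refl

  crossings-even : ∀ side → odd (count (crosses side) S) ≡ false
  crossings-even side =
    trans (crossings-parity side v (vs ++ [ v ])) (trans (cong (λ z → side v xor side z) (last-++ v vs v)) (xor-same (side v)))

  crossings-nonzero : ∀ side {a b} → a ∈ v ∷ vs → b ∈ v ∷ vs → side a ≡ true → side b ≡ false →
    count (crosses side) S ≢ 0
  crossings-nonzero side a∈ b∈ side-a side-b none
    with trans (sym side-a) (trans (no-crossings side v (vs ++ [ v ]) none (∈-++⁺ˡ a∈))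
           (sym (trans (sym side-b) (no-crossings side v (vs ++ [ v ]) none (∈-++⁺ˡ b∈)))))
  ... | ()

-- A Hamiltonian cycle forces odd runs

Pred : ℕ → Set
Pred zero    = Bool
Pred (suc n) = Bool → Pred n

Valid : ∀ n → Pred n → Set
Valid zero    b = T b
Valid (suc n) f = ∀ b → Valid n (f b)

valid? : ∀ n → Pred n → Bool
valid? zero    b = b
valid? (suc n) f = valid? n (f false) ∧ valid? n (f true)

∧-elim : ∀ {a b} → T (a ∧ b) → T a × T b
∧-elim {true} t = _ , t

∧-intro : ∀ {a b} → T a → T b → T (a ∧ b)
∧-intro {true} _ t = t

valid?-sound : ∀ n f → T (valid? n f) → Valid n f
valid?-sound zero    b t       = t
valid?-sound (suc n) f t false = valid?-sound n (f false) (proj₁ (∧-elim t))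
valid?-sound (suc n) f t true  = valid?-sound n (f true)  (proj₂ (∧-elim t))

_⇒_ : Bool → Bool → Bool
a ⇒ b = not a ∨ b

⇒-elim : ∀ {a b} → T (a ⇒ b) → T a → T b
⇒-elim {true} t _ = t

#true : List Bool → ℕ
#true = count (λ b → b)

two : List Bool → Bool
two bs = #true bs ≡ᵇ 2

two-intro : ∀ {k} → k ≡ 2 → T (k ≡ᵇ 2)
two-intro refl = _

-- The local constraints at the points of line x + 1 (or of line 0): b m t and B M T are the
-- bottom, middle and top edges crossing lines between columns x, x + 1 and x + 1, x + 2;
-- v₀ and v₁ are the lower and upper vertical edges on line x + 1.  Each check is
-- discharged by evaluating it on all assignments.
first-column-check : Pred 5
first-column-check B M T v₀ v₁ =
  (two (B ∷ v₀ ∷ []) ∧ two (M ∷ v₁ ∷ v₀ ∷ []) ∧ two (T ∷ false ∷ v₁ ∷ [])) ⇒ not M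

flip-check : Pred 8
flip-check b m t B M T v₀ v₁ =
  (two (b ∷ m ∷ t ∷ []) ∧ two (B ∷ M ∷ T ∷ []) ∧ two (B ∷ v₀ ∷ b ∷ [])
    ∧ two (M ∷ v₁ ∷ m ∷ v₀ ∷ []) ∧ two (T ∷ false ∷ t ∷ v₁ ∷ [])) ⇒ (M xor m)

end-check : Pred 7
end-check b m t B M v₀ v₁ =
  (two (b ∷ m ∷ t ∷ []) ∧ two (B ∷ v₀ ∷ b ∷ []) ∧ two (M ∷ v₁ ∷ m ∷ v₀ ∷ [])
    ∧ two (false ∷ false ∷ t ∷ v₁ ∷ [])) ⇒ not m

first-column-valid : Valid 5 first-column-check
first-column-valid = valid?-sound 5 first-column-check _

flip-valid : Valid 8 flip-check
flip-valid = valid?-sound 8 flip-check _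

end-valid : Valid 7 end-check
end-valid = valid?-sound 7 end-check _

crossing-line : ∀ x c → ((x <ᵇ suc c) xor (x <ᵇ c)) ≡ true → x ≡ c
crossing-line zero    zero    _ = refl
crossing-line zero    (suc c) ()
crossing-line (suc x) zero    ()
crossing-line (suc x) (suc c) t = cong suc (crossing-line x c t)

split-height : ∀ b h → h ≤ 2 → ind b ≡ ind (b ∧ (h ≡ᵇ 0)) ℕ.+ (ind (b ∧ (h ≡ᵇ 1)) ℕ.+ (ind (b ∧ (h ≡ᵇ 2)) ℕ.+ 0))
split-height false h _                   = refl
split-height true  0 _                   = refl
split-height true  1 _                   = refl
split-height true  2 _                   = refl
split-height true  (suc (suc (suc h))) (s≤s (s≤s ()))

even-nonzero : ∀ a b c → odd (#true (a ∷ b ∷ c ∷ [])) ≡ false → #true (a ∷ b ∷ c ∷ []) ≢ 0 →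
  #true (a ∷ b ∷ c ∷ []) ≡ 2
even-nonzero true  true  true  () _
even-nonzero true  true  false _ _ = refl
even-nonzero true  false true  _ _ = refl
even-nonzero true  false false () _
even-nonzero false true  true  _ _ = refl
even-nonzero false true  false () _
even-nonzero false false true  () _
even-nonzero false false false _ nz = ⊥-elim (nz refl)

module Necessary {n : ℕ} (w : Word (suc n)) (v : Point) (vs : List Point) (ham : IsHamCycle w (v ∷ vs)) where
  open Bargraph w
  open CyclicOrder (≡-dec ℕ._≟_ ℕ._≟_) v vs (proj₁ (proj₂ ham)) (proj₁ ham)

  covers : ∀ p → Vertex w p → p ∈ v ∷ vs
  covers = proj₁ (proj₂ (proj₂ ham))

  only-vertices : ∀ p → p ∈ v ∷ vs → Vertex w p
  only-vertices = proj₁ (proj₂ (proj₂ (proj₂ ham)))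

  step-adj : ∀ {a b} → Step a b → Adj w a b
  step-adj = steps-linked (proj₂ (proj₂ (proj₂ (proj₂ ham))))

  unused : ∀ {a b} → ¬ Adj w a b → used a b ≡ false
  unused {a} {b} ¬adj with used a b in eq
  ... | false = refl
  ... | true with used-sound eq
  ...   | inj₁ ab = ⊥-elim (¬adj (step-adj ab))
  ...   | inj₂ ba = ⊥-elim (¬adj (adj-sym (step-adj ba)))

  degree : ∀ p → Vertex w p → count (used p) (neighbours p) ≡ 2
  degree p vertex = degree-two (covers p vertex) (neighbours p) (neighbours-unique p) λ where
    (inj₁ pq) → adj-neighbour (step-adj pq)
    (inj₂ qp) → adj-neighbour (adj-sym (step-adj qp))

  bottom middle topEdge lowerRung upperRung : ℕ → Bool
  bottom    c = used (c , 0) (suc c , 0)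
  middle    c = used (c , 1) (suc c , 1)
  topEdge   c = used (c , 2) (suc c , 2)
  lowerRung x = used (x , 0) (x , 1)
  upperRung x = used (x , 1) (x , 2)

  nothing-above : ∀ x → used (x , 2) (x , 3) ≡ false
  nothing-above x = unused (no-edge-above x)

  degree-0-0 : #true (bottom 0 ∷ lowerRung 0 ∷ []) ≡ 2
  degree-0-0 = degree (0 , 0) (vertex-low z≤n z≤n)

  degree-0-1 : #true (middle 0 ∷ upperRung 0 ∷ lowerRung 0 ∷ []) ≡ 2
  degree-0-1 rewrite used-sym (0 , 0) (0 , 1) = degree (0 , 1) (vertex-low z≤n (s≤s z≤n))

  degree-0-2 : tall 0 ≡ true → #true (topEdge 0 ∷ false ∷ upperRung 0 ∷ []) ≡ 2
  degree-0-2 tall-0 rewrite used-sym (0 , 1) (0 , 2) =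
    subst (λ b → #true (topEdge 0 ∷ b ∷ used (0 , 2) (0 , 1) ∷ []) ≡ 2) (nothing-above 0) (degree (0 , 2) (vertex-top tall-0))

  degree-suc-0 : ∀ c → suc c ≤ N → #true (bottom (suc c) ∷ lowerRung (suc c) ∷ bottom c ∷ []) ≡ 2
  degree-suc-0 c c+1≤N rewrite used-sym (c , 0) (suc c , 0) = degree (suc c , 0) (vertex-low c+1≤N z≤n)

  degree-suc-1 : ∀ c → suc c ≤ N → #true (middle (suc c) ∷ upperRung (suc c) ∷ middle c ∷ lowerRung (suc c) ∷ []) ≡ 2
  degree-suc-1 c c+1≤N rewrite used-sym (c , 1) (suc c , 1) | used-sym (suc c , 0) (suc c , 1) =
    degree (suc c , 1) (vertex-low c+1≤N (s≤s z≤n))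

  degree-suc-2 : ∀ c → top (suc c) ≡ true → #true (topEdge (suc c) ∷ false ∷ topEdge c ∷ upperRung (suc c) ∷ []) ≡ 2
  degree-suc-2 c top-c+1 rewrite used-sym (c , 2) (suc c , 2) | used-sym (suc c , 1) (suc c , 2) =
    subst (λ b → #true (topEdge (suc c) ∷ b ∷ used (suc c , 2) (c , 2) ∷ used (suc c , 2) (suc c , 1) ∷ []) ≡ 2)
      (nothing-above (suc c)) (degree (suc c , 2) (vertex-top top-c+1))

  module Cut (c : ℕ) (c<N : c < N) where

    side : Point → Bool
    side p = proj₁ p <ᵇ suc c

    crossesAt : ℕ → Point × Point → Bool
    crossesAt y st = crosses side st ∧ (proj₂ (proj₁ st) ≡ᵇ y)

    ≡ᵇ-true : ∀ y → (y ≡ᵇ y) ≡ true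
    ≡ᵇ-true zero    = refl
    ≡ᵇ-true (suc y) = ≡ᵇ-true y

    crossesAt-→ : ∀ y → crossesAt y ((c , y) , (suc c , y)) ≡ true
    crossesAt-→ y rewrite <ᵇ-true (ℕP.n<1+n c) | <ᵇ-false (ℕP.≤-refl {c}) | ≡ᵇ-true y = refl

    crossesAt-← : ∀ y → crossesAt y ((suc c , y) , (c , y)) ≡ true
    crossesAt-← y rewrite <ᵇ-true (ℕP.n<1+n c) | <ᵇ-false (ℕP.≤-refl {c}) | ≡ᵇ-true y = refl

    crossesAt-only : ∀ y {p q} → Adj w p q → crossesAt y (p , q) ≡ true →
      (p , q) ≡ ((c , y) , (suc c , y)) ⊎ (p , q) ≡ ((suc c , y) , (c , y))
    crossesAt-only y {x , h} {_ , _} (inj₁ (refl , refl , _)) at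
      with ∧-true⁻ ((x <ᵇ suc c) xor (x <ᵇ c)) (h ≡ᵇ y) at
    ... | crossing , height rewrite crossing-line x c crossing | ℕP.≡ᵇ⇒≡ h y (subst T (sym height) _) = inj₁ refl
    crossesAt-only y {suc x , h} {_ , _} (inj₂ (inj₁ (refl , refl , _))) at
      with ∧-true⁻ ((x <ᵇ c) xor (x <ᵇ suc c)) (h ≡ᵇ y) at
    ... | crossing , height
      rewrite crossing-line x c (trans (xor-comm (x <ᵇ suc c) (x <ᵇ c)) crossing) | ℕP.≡ᵇ⇒≡ h y (subst T (sym height) _)
      = inj₂ refl
    crossesAt-only y {x , h} {_ , _} (inj₂ (inj₂ (inj₁ (refl , refl , _)))) at
      rewrite xor-same (x <ᵇ suc c) with at
    ... | ()
    crossesAt-only y {x , h} {_ , _} (inj₂ (inj₂ (inj₂ (refl , refl , _)))) at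
      rewrite xor-same (x <ᵇ suc c) with at
    ... | ()

    height≤2 : ∀ {st} → st ∈ S → proj₂ (proj₁ st) ≤ 2
    height≤2 st∈ with vertex⁻ (only-vertices _ (step-source-∈ st∈))
    ... | _ , inj₁ y≤1       = ℕP.≤-trans y≤1 (s≤s z≤n)
    ... | _ , inj₂ (refl , _) = ℕP.≤-refl

    crossings : count (crosses side) S ≡ #true (bottom c ∷ middle c ∷ topEdge c ∷ [])
    crossings = trans (count-split₃ (crosses side) (crossesAt 0) (crossesAt 1) (crossesAt 2) S
                         (λ {st} st∈ → split-height (crosses side st) _ (height≤2 st∈)))
      (cong₂ ℕ._+_ (edge 0) (cong₂ ℕ._+_ (edge 1) (cong (ℕ._+ 0) (edge 2))))
      where
      edge : ∀ y → count (crossesAt y) S ≡ ind (used (c , y) (suc c , y))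
      edge y = count-edge (crossesAt y) (crossesAt-→ y) (crossesAt-← y) λ st∈ → crossesAt-only y (step-adj st∈)

    cut : #true (bottom c ∷ middle c ∷ topEdge c ∷ []) ≡ 2
    cut = even-nonzero (bottom c) (middle c) (topEdge c)
      (subst (λ k → odd k ≡ false) crossings (crossings-even side))
      (subst (_≢ 0) crossings
        (crossings-nonzero side (covers (0 , 0) (vertex-low z≤n z≤n)) (covers (N , 0) (vertex-low ℕP.≤-refl z≤n))
          refl (<ᵇ-false c<N)))

  T⇒not-false : ∀ {b} → T (not b) → b ≡ false
  T⇒not-false {false} _ = refl

  T-xor : ∀ {a b} → T (a xor b) → a ≡ not b
  T-xor {true}  {false} _ = refl
  T-xor {false} {true}  _ = refl

  first-column : tall 0 ≡ true → middle 0 ≡ false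
  first-column tall-0 = T⇒not-false (⇒-elim
    (first-column-valid (bottom 0) (middle 0) (topEdge 0) (lowerRung 0) (upperRung 0))
    (∧-intro (two-intro degree-0-0) (∧-intro (two-intro degree-0-1) (two-intro (degree-0-2 tall-0)))))

  middle-flips : ∀ c → tall (suc c) ≡ true → middle (suc c) ≡ not (middle c)
  middle-flips c tall-c+1 = T-xor (⇒-elim
    (flip-valid (bottom c) (middle c) (topEdge c) (bottom (suc c)) (middle (suc c)) (topEdge (suc c))
                (lowerRung (suc c)) (upperRung (suc c)))
    (∧-intro (two-intro (Cut.cut c (ℕP.<-trans (ℕP.n<1+n c) c+1<N))) (∧-intro (two-intro (Cut.cut (suc c) c+1<N))
      (∧-intro (two-intro (degree-suc-0 c c+1<N′)) (∧-intro (two-intro (degree-suc-1 c c+1<N′))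
        (two-intro (degree-suc-2 c (trans (cong (tall c ∨_) tall-c+1) (∨-zeroʳ (tall c))))))))))
    where
    c+1<N : suc c < N
    c+1<N = bit-true⇒< w (suc c) tall-c+1
    c+1<N′ : suc c ≤ N
    c+1<N′ = ℕP.<⇒≤ c+1<N

  run-ends-odd : ∀ c → tall c ≡ true → tall (suc c) ≡ false → middle c ≡ false
  run-ends-odd c tall-c short-c+1 = T⇒not-false (⇒-elim
    (end-valid (bottom c) (middle c) (topEdge c) (bottom (suc c)) (middle (suc c)) (lowerRung (suc c)) (upperRung (suc c)))
    (∧-intro (two-intro (Cut.cut c c<N)) (∧-intro (two-intro (degree-suc-0 c c<N)) (∧-intro (two-intro (degree-suc-1 c c<N))
      (two-intro (subst (λ t → #true (t ∷ false ∷ topEdge c ∷ upperRung (suc c) ∷ []) ≡ 2)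
                   (unused (no-top-edge (suc c) short-c+1)) (degree-suc-2 c (cong (_∨ tall (suc c)) tall-c))))))))
    where
    c<N : c < N
    c<N = bit-true⇒< w c tall-c

  short-column : ∀ c → c < N → tall c ≡ false → middle c ≡ true
  short-column c c<N short-c = both-used (bottom c) (middle c)
    (subst (λ t → #true (bottom c ∷ middle c ∷ t ∷ []) ≡ 2) (unused (no-top-edge c short-c)) (Cut.cut c c<N))
    where
    both-used : ∀ b m → #true (b ∷ m ∷ false ∷ []) ≡ 2 → m ≡ true
    both-used b     true  _  = refl
    both-used true  false ()
    both-used false false ()

  middle-parity : ∀ c → c < N → middle c ≡ not (odd (run 0 tall (suc c)))
  middle-parity c c<N with tall c in tall-c
  ... | false = short-column c c<N tall-c
  middle-parity zero    _     | true = first-column tall-c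
  middle-parity (suc c) c+1<N | true =
    trans (middle-flips c tall-c) (cong not (middle-parity c (ℕP.<-trans (ℕP.n<1+n c) c+1<N)))

  odd-runs : OddRuns tall
  odd-runs zero    _         = refl
  odd-runs (suc c) short-c+1 = by-cases (tall c) refl
    where
    by-cases : ∀ b → tall c ≡ b → canEnd (run 0 tall (suc c)) ≡ true
    by-cases false short-c rewrite run-false {0} {tall} c short-c = refl
    by-cases true  tall-c = odd⇒canEnd {run 0 tall (suc c)} (not-false (trans (sym (middle-parity c (bit-true⇒< w c tall-c)))
                                                          (run-ends-odd c tall-c short-c+1)))
      where
      not-false : ∀ {b} → not b ≡ false → b ≡ true
      not-false {true} _ = refl

-- Counting

2*[n/2]≤n : ∀ n → 2 ℕ.* (n / 2) ≤ n
2*[n/2]≤n n = subst (_≤ n) (ℕP.*-comm (n / 2) 2) (m/n*n≤m n 2)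

n≤1+2*[n/2] : ∀ n → n ≤ suc (2 ℕ.* (n / 2))
n≤1+2*[n/2] n = begin
  n                      ≡⟨ m≡m%n+[m/n]*n n 2 ⟩
  n % 2 ℕ.+ n / 2 ℕ.* 2  ≤⟨ ℕP.+-monoˡ-≤ (n / 2 ℕ.* 2) (ℕP.≤-pred (m%n<n n 2)) ⟩
  suc (n / 2 ℕ.* 2)      ≡⟨ cong suc (ℕP.*-comm (n / 2) 2) ⟩
  suc (2 ℕ.* (n / 2))    ∎
  where open ℕP.≤-Reasoning

hamiltonian⇔oddRuns : ∀ {n} (w : Word (suc n)) → (HasHamCycle w → OddRuns (bit w)) × (OddRuns (bit w) → HasHamCycle w)
hamiltonian⇔oddRuns w = necessary , Construction.hamiltonian w
  where
  necessary : HasHamCycle w → OddRuns (bit w)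
  necessary ([]     , ())
  necessary (v ∷ vs , ham) = Necessary.odd-runs w v vs ham

hamiltonian-words-counted : ∀ k n → CountIs (suc n) (λ w → NoKOnes k w × HasHamCycle w) (#words k (suc n) 0)
hamiltonian-words-counted k n = words k (suc n) 0 , words-unique k (suc n) 0 , membership , refl
  where
  membership : ∀ w → (w ∈ words k (suc n) 0 → NoKOnes k w × HasHamCycle w)
                   × (NoKOnes k w × HasHamCycle w → w ∈ words k (suc n) 0)
  membership w =
    (λ w∈ → let noK , oddRuns = words-sound₀ k w w∈ in noK , proj₂ (hamiltonian⇔oddRuns w) oddRuns) ,
    (λ (noK , ham) → words-complete₀ k w noK (proj₁ (hamiltonian⇔oddRuns w) ham))

corollary4p2 : (k : ℕ) → 2 ≤ k →
    Σ (ℕ → ℕ) λ a →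
      ((n : ℕ) → CountIs (suc n) (λ w → NoKOnes k w × HasHamCycle w) (a (suc n)))
      × ((i : ℕ) → (denom k ⊛ genFun a) i ≡ numer k i)
corollary4p2 k 2≤k =
  (λ n → #words k n 0) ,
  hamiltonian-words-counted k ,
  denom-⊛-genFun k (λ n → #words k n 0) (#words-[] 0<k)
    (WordCount.A-recurrence k (k / 2) 0<k (2*[n/2]≤n k) (n≤1+2*[n/2] k))
  where
  0<k : 0 < k
  0<k = ℕP.<-trans (s≤s z≤n) 2≤k
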